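{- For every $n\ge 9$ there exists a $1$-critical tree of order $n$. Moreover, for every $n\ge 5$ there exists a $1$-critical graph of order $n$ that is not a tree.
   Context: All graphs are finite and simple. $\mu(G,x)=\sum_k(-1)^kp_G(k)x^{n-2k}$ is the matching polynomial of a graph $G$ on $n$ vertices, where $p_G(k)$ is the number of $k$-edge matchings; $m(1,G)$ is the multiplicity of $1$ as a root of $\mu(G,x)$. $G\setminus u$ is $G$ with vertex $u$ deleted. A graph $G$ is $1$-critical if $1$ is a root of $\mu(G,x)$ and every vertex $u$ of $G$ satisfies $m(1,G\setminus u)=m(1,G)-1$. -}

module Defs where

open import Data.Nat as ℕ using (ℕ; zero; suc; _≤_; _∸_; ⌊_/2⌋; _≡ᵇ_; _<ᵇ_)
open import Data.Integer as ℤ using (ℤ; +_; -_)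
open import Data.Bool using (Bool; true; false; _∧_; _∨_; not; T)
open import Data.Fin as Fin using (Fin; toℕ; punchIn)
open import Data.Fin.Properties using (_≟_)
open import Data.List as L using (List; []; _∷_; _++_; map; length; filterᵇ; allFin; concatMap; upTo; foldr)
open import Data.List.Relation.Unary.Unique.Propositional using (Unique)
open import Data.Product using (Σ; _×_; _,_; ∃; ∃-syntax)
open import Data.Empty using (⊥)
open import Relation.Nullary using (¬_)
open import Relation.Nullary.Decidable using (isYes)
open import Relation.Binary.PropositionalEquality using (_≡_)

record Graph (n : ℕ) : Set where
  field
    adj    : Fin n → Fin n → Bool
    sym    : ∀ i j → adj i j ≡ adj j i
    irrefl : ∀ i → adj i i ≡ false
open Graph public

Adj : ∀ {n} → Graph n → Fin n → Fin n → Set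
Adj G i j = T (adj G i j)

delete : ∀ {k} → Graph (suc k) → Fin (suc k) → Graph k
delete G u = record
  { adj    = λ i j → adj G (punchIn u i) (punchIn u j)
  ; sym    = λ i j → sym G (punchIn u i) (punchIn u j)
  ; irrefl = λ i → irrefl G (punchIn u i)
  }

data Walk {n} (G : Graph n) : Fin n → Fin n → Set where
  here : ∀ {i} → Walk G i i
  step : ∀ {i j k} → Adj G i j → Walk G j k → Walk G i k

Connected : ∀ {n} → Graph n → Set
Connected G = ∀ i j → Walk G i j

data IsPath {n} (G : Graph n) : List (Fin n) → Set where
  nil  : IsPath G []
  one  : ∀ {v} → IsPath G (v ∷ [])
  cons : ∀ {u v vs} → Adj G u v → IsPath G (v ∷ vs) → IsPath G (u ∷ v ∷ vs)

last : ∀ {A : Set} → A → List A → A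
last a []       = a
last a (b ∷ bs) = last b bs

HasCycle : ∀ {n} → Graph n → Set
HasCycle {n} G = ∃[ v ] ∃[ vs ]
  (2 ≤ length vs × Unique (v ∷ vs) × IsPath G (v ∷ vs) × Adj G (last v vs) v)

IsTree : ∀ {n} → Graph n → Set
IsTree G = Connected G × ¬ HasCycle G

edges : ∀ {n} → Graph n → List (Fin n × Fin n)
edges {n} G = filterᵇ (λ { (i , j) → (toℕ i <ᵇ toℕ j) ∧ adj G i j })
                      (concatMap (λ i → map (i ,_) (allFin n)) (allFin n))

sublists : ∀ {A : Set} → List A → List (List A)
sublists []       = [] ∷ []
sublists (x ∷ xs) = map (x ∷_) (sublists xs) ++ sublists xs

disjointᵇ : ∀ {n} → Fin n × Fin n → Fin n × Fin n → Bool
disjointᵇ (a , b) (c , d) =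
  not (isYes (a ≟ c) ∨ isYes (a ≟ d) ∨ isYes (b ≟ c) ∨ isYes (b ≟ d))

allᵇ : ∀ {A : Set} → (A → Bool) → List A → Bool
allᵇ f []       = true
allᵇ f (x ∷ xs) = f x ∧ allᵇ f xs

isMatchingᵇ : ∀ {n} → List (Fin n × Fin n) → Bool
isMatchingᵇ []       = true
isMatchingᵇ (e ∷ es) = allᵇ (disjointᵇ e) es ∧ isMatchingᵇ es

p : ∀ {n} → Graph n → ℕ → ℕ
p G k = length (filterᵇ (λ M → isMatchingᵇ M ∧ (length M ≡ᵇ k)) (sublists (edges G)))

-- Integer polynomials as coefficient lists (constant term first)

Poly : Set
Poly = List ℤ

coeff : Poly → ℕ → ℤ
coeff []       _       = + 0
coeff (a ∷ _)  zero    = a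
coeff (_ ∷ as) (suc i) = coeff as i

_+P_ : Poly → Poly → Poly
[]       +P q        = q
(a ∷ as) +P []       = a ∷ as
(a ∷ as) +P (b ∷ bs) = (a ℤ.+ b) ∷ (as +P bs)

_*P_ : Poly → Poly → Poly
[]       *P q = []
(a ∷ as) *P q = map (a ℤ.*_) q +P (+ 0 ∷ (as *P q))

monomial : ℕ → ℤ → Poly
monomial zero    c = c ∷ []
monomial (suc d) c = + 0 ∷ monomial d c

_^P_ : Poly → ℕ → Poly
q ^P zero  = + 1 ∷ []
q ^P suc m = q *P (q ^P m)

x-1 : Poly
x-1 = - (+ 1) ∷ + 1 ∷ []

_∣P_ : Poly → Poly → Set
d ∣P f = ∃[ q ] (∀ i → coeff f i ≡ coeff (d *P q) i)

RootMult1 : Poly → ℕ → Set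
RootMult1 f m = (x-1 ^P m) ∣P f × ¬ ((x-1 ^P suc m) ∣P f)

-- Matching polynomial  μ(G,x) = Σ_k (-1)^k p_G(k) x^(n-2k)

sign : ℕ → ℤ
sign zero    = + 1
sign (suc k) = - sign k

μ : ∀ {n} → Graph n → Poly
μ {n} G = foldr _+P_ []
  (map (λ k → monomial (n ∸ (k ℕ.+ k)) (sign k ℤ.* + p G k)) (upTo (suc ⌊ n /2⌋)))

OneCritical : ∀ {n} → Graph n → Set
OneCritical {zero}  G = ∃[ m ] (1 ≤ m × RootMult1 (μ G) m)
OneCritical {suc k} G = ∃[ m ] (1 ≤ m × RootMult1 (μ G) m
                          × (∀ u → RootMult1 (μ (delete G u)) (m ∸ 1)))

-- If μ(G, 1) = 0 and the values μ(G ∖ u, 1) are nonzero with one common sign, then G is 1-critical: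
-- by Godsil's identity μ′(G, x) = Σ_u μ(G ∖ u, x) the root 1 of μ(G) is simple and no μ(G ∖ u) vanishes at 1.
-- All these values are signed counts of matchings of induced subgraphs, related by the vertex recurrence
-- μ(G) = μ(G ∖ u) - Σ_{v ~ u} μ(G ∖ u ∖ v).
-- Replacing an edge ab by a path a – x – y – z – b negates μ(G, 1) and every μ(G ∖ u, 1) with u old, and gives
-- μ(G′ ∖ x, 1) = -μ(G ∖ b, 1), μ(G′ ∖ z, 1) = -μ(G ∖ a, 1) and, as μ(G, 1) = 0,
-- μ(G′ ∖ y, 1) = -(μ(G ∖ a, 1) + μ(G ∖ b, 1) - 2 μ(G ∖ a ∖ b, 1)). So if this last bracket also has the
-- common sign, the situation recurs in G′, three vertices larger, with the opposite sign and the edge zb.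
-- Subdivision keeps trees trees and keeps a cycle through the edge, so it suffices to exhibit such trees on
-- 9, 10, 11 vertices and such non-trees on 5, 6, 7 vertices, which are checked by evaluation.

module Submission where

open import Defs hiding (sym)

open import Data.Bool using (Bool; true; false; _∧_; _∨_; not; T; if_then_else_)
import Data.Bool.Properties as BP
open import Data.Bool.Solver using (module ∨-∧-Solver)
open import Data.Empty using (⊥; ⊥-elim)
open import Data.Fin as Fin using (Fin; zero; suc; toℕ; punchIn; punchOut; #_)
import Data.Fin.Properties as FinP
open import Data.Integer as ℤ using (ℤ; +_; -_; _+_; _*_; _-_)
import Data.Integer.Properties as ℤP
open import Data.Integer.Tactic.RingSolver using (solve-∀)
open import Data.List using (List; []; _∷_; _++_; map; length; filterᵇ; allFin; tabulate; concatMap; upTo; applyUpTo; foldr; drop)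
open import Data.List.Membership.Propositional using (_∈_)
import Data.List.Membership.Propositional.Properties as ∈P
import Data.List.Properties as ListP
open import Data.List.Relation.Unary.All as All using (All; []; _∷_)
import Data.List.Relation.Unary.All.Properties as AllP
open import Data.List.Relation.Unary.AllPairs as AllPairs using (AllPairs; []; _∷_)
import Data.List.Relation.Unary.AllPairs.Properties as AllPairsP
open import Data.List.Relation.Unary.Any using (here; there)
open import Data.List.Relation.Unary.Unique.Propositional using (Unique)
open import Data.Nat as ℕ using (ℕ; zero; suc; _≤_; _<_; _∸_; _≡ᵇ_; _<ᵇ_; ⌊_/2⌋; z≤n; s≤s)
import Data.Nat.Properties as ℕP
import Data.Nat.Tactic.RingSolver as ℕSolver
open import Data.Product using (Σ; _×_; _,_; proj₁; proj₂; ∃-syntax)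
open import Data.Sum using (_⊎_; inj₁; inj₂)
open import Data.Vec using (Vec; []; _∷_; lookup)
open import Function using (_∘_; Equivalence)
open import Relation.Binary using (tri<; tri≈; tri>)
open import Relation.Binary.PropositionalEquality
open import Relation.Nullary using (¬_; yes; no)
open import Relation.Nullary.Decidable using (isYes; T?; True; toWitness; ¬?)

open import Algebra.Lattice.Properties.BooleanAlgebra BP.∨-∧-booleanAlgebra using (deMorgan₂)
open import Algebra.Properties.CommutativeSemigroup ℤP.+-commutativeSemigroup using (interchange)
import Algebra.Solver.CommutativeMonoid BP.∧-commutativeMonoid as ∧-Solver
import Algebra.Solver.CommutativeMonoid BP.∨-commutativeMonoid as ∨-Solver

variable
  A B : Set
  m n : ℕ

infix 7 _==_
_==_ : Fin m → Fin m → Bool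
zero  == zero  = true
zero  == suc _ = false
suc _ == zero  = false
suc i == suc j = i == j

==-refl : (i : Fin m) → (i == i) ≡ true
==-refl zero    = refl
==-refl (suc i) = ==-refl i

==⇒≡ : {i j : Fin m} → (i == j) ≡ true → i ≡ j
==⇒≡ {i = zero}  {zero}  _ = refl
==⇒≡ {i = suc i} {suc j} e = cong suc (==⇒≡ e)

==-sym : (i j : Fin m) → (i == j) ≡ (j == i)
==-sym zero    zero    = refl
==-sym zero    (suc j) = refl
==-sym (suc i) zero    = refl
==-sym (suc i) (suc j) = ==-sym i j

==-false⇒≢ : {i j : Fin m} → (i == j) ≡ false → i ≢ j
==-false⇒≢ {i = i} e refl with () ← trans (sym e) (==-refl i)

≢⇒==-false : {i j : Fin m} → i ≢ j → (i == j) ≡ false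
≢⇒==-false {i = i} {j} i≢j with i == j in e
... | true  = ⊥-elim (i≢j (==⇒≡ e))
... | false = refl

isYes-≟ : (i j : Fin m) → isYes (i Fin.≟ j) ≡ (i == j)
isYes-≟ i j with i Fin.≟ j
... | yes refl = sym (==-refl i)
... | no i≢j   = sym (≢⇒==-false i≢j)

∧-true : {a b : Bool} → (a ∧ b) ≡ true → a ≡ true × b ≡ true
∧-true {true} {true} _ = refl , refl

∨-true : {a b : Bool} → (a ∨ b) ≡ true → a ≡ true ⊎ b ≡ true
∨-true {true}  _ = inj₁ refl
∨-true {false} b≡true = inj₂ b≡true

not-true : {a : Bool} → not a ≡ true → a ≡ false
not-true {false} _ = refl

not-∨-∧ : ∀ x y q → not (x ∨ y) ∧ q ≡ not y ∧ (not x ∧ q)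
not-∨-∧ true  true  q = refl
not-∨-∧ true  false q = refl
not-∨-∧ false true  q = refl
not-∨-∧ false false q = refl

T⇒≡ : {b : Bool} → T b → b ≡ true
T⇒≡ = Equivalence.to BP.T-≡

≡⇒T : {b : Bool} → b ≡ true → T b
≡⇒T = Equivalence.from BP.T-≡


<ᵇ-true⇒< : {x y : ℕ} → (x <ᵇ y) ≡ true → x < y
<ᵇ-true⇒< {x} {y} x<ᵇy = ℕP.<ᵇ⇒< x y (≡⇒T x<ᵇy)

<⇒<ᵇ-true : {x y : ℕ} → x < y → (x <ᵇ y) ≡ true
<⇒<ᵇ-true x<y = T⇒≡ (ℕP.<⇒<ᵇ x<y)

<ᵇ-false⇒≥ : {x y : ℕ} → (x <ᵇ y) ≡ false → y ≤ x
<ᵇ-false⇒≥ {x} {y} x≮ᵇy = ℕP.≮⇒≥ x≮y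
  where
  x≮y : ¬ x < y
  x≮y x<y with () ← trans (sym x≮ᵇy) (<⇒<ᵇ-true x<y)

all-filterᵇ : (p : A → Bool) (xs : List A) → All (λ x → p x ≡ true) (filterᵇ p xs)
all-filterᵇ p xs = All.map T⇒≡ (AllP.all-filter (T? ∘ p) xs)

allᵇ-mono : (p q : A → Bool) → (∀ x → p x ≡ true → q x ≡ true) →
            ∀ xs → allᵇ p xs ≡ true → allᵇ q xs ≡ true
allᵇ-mono p q p⇒q []       _   = refl
allᵇ-mono p q p⇒q (x ∷ xs) all with p x in px
... | true rewrite p⇒q x px = allᵇ-mono p q p⇒q xs all

filterᵇ-cong : {p q : A → Bool} → (∀ x → p x ≡ q x) → (xs : List A) → filterᵇ p xs ≡ filterᵇ q xs
filterᵇ-cong p≗q []       = refl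
filterᵇ-cong {p = p} {q} p≗q (x ∷ xs) with p x in px | q x in qx
... | true  | true  = cong (x ∷_) (filterᵇ-cong p≗q xs)
... | false | false = filterᵇ-cong p≗q xs
... | true  | false with () ← trans (sym px) (trans (p≗q x) qx)
... | false | true  with () ← trans (sym qx) (trans (sym (p≗q x)) px)

filterᵇ-filterᵇ : (p q : A → Bool) (xs : List A) → filterᵇ p (filterᵇ q xs) ≡ filterᵇ (λ x → q x ∧ p x) xs
filterᵇ-filterᵇ p q []       = refl
filterᵇ-filterᵇ p q (x ∷ xs) with q x in qx
... | false = filterᵇ-filterᵇ p q xs
... | true with p x in px
...   | true  = cong (x ∷_) (filterᵇ-filterᵇ p q xs)
...   | false = filterᵇ-filterᵇ p q xs

filterᵇ-reject : (p : A → Bool) {x : A} (xs : List A) → p x ≡ false → filterᵇ p (x ∷ xs) ≡ filterᵇ p xs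
filterᵇ-reject p xs ¬px rewrite ¬px = refl

filterᵇ-comm : (p q : A → Bool) (xs : List A) → filterᵇ p (filterᵇ q xs) ≡ filterᵇ q (filterᵇ p xs)
filterᵇ-comm p q xs =
  trans (filterᵇ-filterᵇ p q xs)
        (trans (filterᵇ-cong (λ x → BP.∧-comm (q x) (p x)) xs) (sym (filterᵇ-filterᵇ q p xs)))

∈-filterᵇ⁺ : (p : A → Bool) {x : A} {xs : List A} → x ∈ xs → p x ≡ true → x ∈ filterᵇ p xs
∈-filterᵇ⁺ p x∈xs px = ∈P.∈-filter⁺ (T? ∘ p) x∈xs (≡⇒T px)

∈-filterᵇ⁻ : (p : A → Bool) {x : A} {xs : List A} → x ∈ filterᵇ p xs → x ∈ xs × p x ≡ true
∈-filterᵇ⁻ p x∈ with x∈xs , px ← ∈P.∈-filter⁻ (T? ∘ p) x∈ = x∈xs , T⇒≡ px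

last∈ : (w x : A) (ws : List A) → last w (x ∷ ws) ∈ x ∷ ws
last∈ w x []       = here refl
last∈ w x (y ∷ ws) = there (last∈ x y ws)

sublists-map : (g : A → B) (xs : List A) → sublists (map g xs) ≡ map (map g) (sublists xs)
sublists-map g []       = refl
sublists-map g (x ∷ xs) rewrite sublists-map g xs = sym (begin
  map (map g) (map (x ∷_) (sublists xs) ++ sublists xs)
    ≡⟨ ListP.map-++ (map g) (map (x ∷_) (sublists xs)) (sublists xs) ⟩
  map (map g) (map (x ∷_) (sublists xs)) ++ map (map g) (sublists xs)
    ≡⟨ cong (_++ map (map g) (sublists xs)) (sym (ListP.map-∘ (sublists xs))) ⟩
  map (map g ∘ (x ∷_)) (sublists xs) ++ map (map g) (sublists xs)
    ≡⟨ cong (_++ map (map g) (sublists xs)) (ListP.map-∘ (sublists xs)) ⟩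
  map (g x ∷_) (map (map g) (sublists xs)) ++ map (map g) (sublists xs) ∎)
  where open ≡-Reasoning

ΣL : (A → ℤ) → List A → ℤ
ΣL f []       = + 0
ΣL f (x ∷ xs) = f x + ΣL f xs

ΣL-cong : {f g : A → ℤ} → (∀ x → f x ≡ g x) → ∀ xs → ΣL f xs ≡ ΣL g xs
ΣL-cong f≗g []       = refl
ΣL-cong f≗g (x ∷ xs) = cong₂ _+_ (f≗g x) (ΣL-cong f≗g xs)

ΣL-zero : (xs : List A) → ΣL (λ _ → + 0) xs ≡ + 0
ΣL-zero []       = refl
ΣL-zero (x ∷ xs) = trans (ℤP.+-identityˡ _) (ΣL-zero xs)

ΣL-++ : (f : A → ℤ) (xs ys : List A) → ΣL f (xs ++ ys) ≡ ΣL f xs + ΣL f ys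
ΣL-++ f []       ys = sym (ℤP.+-identityˡ _)
ΣL-++ f (x ∷ xs) ys = trans (cong (_+_ (f x)) (ΣL-++ f xs ys)) (sym (ℤP.+-assoc (f x) _ _))

ΣL-map : (f : B → ℤ) (g : A → B) (xs : List A) → ΣL f (map g xs) ≡ ΣL (λ x → f (g x)) xs
ΣL-map f g []       = refl
ΣL-map f g (x ∷ xs) = cong (_+_ (f (g x))) (ΣL-map f g xs)

ΣL-+ : (f g : A → ℤ) (xs : List A) → ΣL (λ x → f x + g x) xs ≡ ΣL f xs + ΣL g xs
ΣL-+ f g []       = refl
ΣL-+ f g (x ∷ xs) = trans (cong (_+_ (f x + g x)) (ΣL-+ f g xs)) (interchange (f x) (g x) _ _)

ΣL-neg : (f : A → ℤ) (xs : List A) → ΣL (λ x → - f x) xs ≡ - ΣL f xs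
ΣL-neg f []       = refl
ΣL-neg f (x ∷ xs) = trans (cong (_+_ (- f x)) (ΣL-neg f xs)) (sym (ℤP.neg-distrib-+ (f x) (ΣL f xs)))

ΣL-- : (f g : A → ℤ) (xs : List A) → ΣL (λ x → f x - g x) xs ≡ ΣL f xs - ΣL g xs
ΣL-- f g xs = trans (ΣL-+ f (λ x → - g x) xs) (cong (_+_ (ΣL f xs)) (ΣL-neg g xs))

ΣL-filterᵇ : (p : A → Bool) (f : A → ℤ) (xs : List A) →
             ΣL f (filterᵇ p xs) ≡ ΣL (λ x → if p x then f x else + 0) xs
ΣL-filterᵇ p f []       = refl
ΣL-filterᵇ p f (x ∷ xs) with p x
... | true  = cong (_+_ (f x)) (ΣL-filterᵇ p f xs)
... | false = trans (ΣL-filterᵇ p f xs) (sym (ℤP.+-identityˡ _))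

ΣF : ∀ m → (Fin m → ℤ) → ℤ
ΣF zero    f = + 0
ΣF (suc m) f = f zero + ΣF m (λ i → f (suc i))

ΣF-cong : ∀ m {f g : Fin m → ℤ} → (∀ i → f i ≡ g i) → ΣF m f ≡ ΣF m g
ΣF-cong zero    f≗g = refl
ΣF-cong (suc m) f≗g = cong₂ _+_ (f≗g zero) (ΣF-cong m (λ i → f≗g (suc i)))

ΣF-zero : ∀ m → ΣF m (λ _ → + 0) ≡ + 0
ΣF-zero zero    = refl
ΣF-zero (suc m) = trans (ℤP.+-identityˡ _) (ΣF-zero m)

ΣF-+ : ∀ m (f g : Fin m → ℤ) → ΣF m (λ i → f i + g i) ≡ ΣF m f + ΣF m g
ΣF-+ zero    f g = refl
ΣF-+ (suc m) f g =
  trans (cong (_+_ (f zero + g zero)) (ΣF-+ m (λ i → f (suc i)) (λ i → g (suc i))))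
        (interchange (f zero) (g zero) _ _)

ΣF-scale : ∀ m (c : ℤ) (f : Fin m → ℤ) → ΣF m (λ i → c * f i) ≡ c * ΣF m f
ΣF-scale zero    c f = sym (ℤP.*-zeroʳ c)
ΣF-scale (suc m) c f =
  trans (cong (_+_ (c * f zero)) (ΣF-scale m c (λ i → f (suc i)))) (sym (ℤP.*-distribˡ-+ c (f zero) _))

ΣF-tabulate : ∀ m (f : A → ℤ) (g : Fin m → A) → ΣL f (tabulate g) ≡ ΣF m (λ i → f (g i))
ΣF-tabulate zero    f g = refl
ΣF-tabulate (suc m) f g = cong (_+_ (f (g zero))) (ΣF-tabulate m f (λ i → g (suc i)))

ΣF-ΣL : ∀ m (g : Fin m → A → ℤ) (xs : List A) →
        ΣF m (λ i → ΣL (g i) xs) ≡ ΣL (λ x → ΣF m (λ i → g i x)) xs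
ΣF-ΣL m g []       = ΣF-zero m
ΣF-ΣL m g (x ∷ xs) =
  trans (ΣF-+ m (λ i → g i x) (λ i → ΣL (g i) xs)) (cong (_+_ (ΣF m (λ i → g i x))) (ΣF-ΣL m g xs))

ΣF-delta : ∀ m (a : Fin m) (g : Fin m → ℤ) → ΣF m (λ v → if v == a then g v else + 0) ≡ g a
ΣF-delta (suc m) zero    g = trans (cong (_+_ (g zero)) (ΣF-zero m)) (ℤP.+-identityʳ _)
ΣF-delta (suc m) (suc a) g = trans (ℤP.+-identityˡ _) (ΣF-delta m a (λ v → g (suc v)))

ΣF-pos : ∀ m (f : Fin (suc m) → ℤ) → (∀ i → + 0 ℤ.< f i) → + 0 ℤ.< ΣF (suc m) f
ΣF-pos m f pos = ℤP.+-mono-<-≤ (pos zero) (nonneg m (λ i → f (suc i)) (λ i → ℤP.<⇒≤ (pos (suc i))))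
  where
  nonneg : ∀ m (f : Fin m → ℤ) → (∀ i → + 0 ℤ.≤ f i) → + 0 ℤ.≤ ΣF m f
  nonneg zero    f _  = ℤP.≤-refl
  nonneg (suc m) f nn = ℤP.+-mono-≤ (nn zero) (nonneg m (λ i → f (suc i)) (λ i → nn (suc i)))

ΣL-cong-All : {P : A → Set} {f g : A → ℤ} → (∀ x → P x → f x ≡ g x) → ∀ xs → All P xs → ΣL f xs ≡ ΣL g xs
ΣL-cong-All f≗g []       []         = refl
ΣL-cong-All f≗g (x ∷ xs) (px ∷ pxs) = cong₂ _+_ (f≗g x px) (ΣL-cong-All f≗g xs pxs)

countF : ∀ m → (Fin m → Bool) → ℕ
countF zero    Q = 0
countF (suc m) Q = (if Q zero then 1 else 0) ℕ.+ countF m (λ i → Q (suc i))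

countF-cong : ∀ m {P Q : Fin m → Bool} → (∀ i → P i ≡ Q i) → countF m P ≡ countF m Q
countF-cong zero    P≗Q = refl
countF-cong (suc m) P≗Q =
  cong₂ ℕ._+_ (cong (λ b → if b then 1 else 0) (P≗Q zero)) (countF-cong m (λ i → P≗Q (suc i)))

countF-true : ∀ m → countF m (λ _ → true) ≡ m
countF-true zero    = refl
countF-true (suc m) = cong suc (countF-true m)

countF-remove : ∀ m (a : Fin m) (Q : Fin m → Bool) → Q a ≡ true →
                countF m (λ u → not (a == u) ∧ Q u) ℕ.+ 1 ≡ countF m Q
countF-remove (suc m) zero    Q Qa rewrite Qa = ℕP.+-comm (countF m (λ i → Q (suc i))) 1
countF-remove (suc m) (suc a) Q Qa with Q zero
... | true  = cong suc (countF-remove m a (λ i → Q (suc i)) Qa)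
... | false = countF-remove m a (λ i → Q (suc i)) Qa

ΣF-indicator : ∀ m (Q : Fin m → Bool) x → ΣF m (λ u → if Q u then x else + 0) ≡ + countF m Q * x
ΣF-indicator zero    Q x = sym (ℤP.*-zeroˡ x)
ΣF-indicator (suc m) Q x with Q zero
... | true  = begin
  x + ΣF m (λ i → if Q (suc i) then x else + 0) ≡⟨ cong (_+_ x) (ΣF-indicator m (λ i → Q (suc i)) x) ⟩
  x + + c * x                                   ≡⟨ cong (_+ + c * x) (ℤP.*-identityˡ x) ⟨
  + 1 * x + + c * x                             ≡⟨ ℤP.*-distribʳ-+ x (+ 1) (+ c) ⟨
  + suc c * x                                   ∎
  where
  open ≡-Reasoning
  c = countF m (λ i → Q (suc i))
... | false = trans (ℤP.+-identityˡ _) (ΣF-indicator m (λ i → Q (suc i)) x)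

ΣF-select : (S : Fin n → Bool) (c : Fin n) (g : Fin n → ℤ) →
            ΣF n (λ i → if S i ∧ i == c then g i else + 0) ≡ (if S c then g c else + 0)
ΣF-select {n} S c g = trans (ΣF-cong n swap) (ΣF-delta n c (λ i → if S i then g i else + 0))
  where
  swap : ∀ i → (if S i ∧ i == c then g i else + 0) ≡ (if i == c then (if S i then g i else + 0) else + 0)
  swap i with S i | i == c
  ... | true  | _     = refl
  ... | false | true  = refl
  ... | false | false = refl

ΣF-split : (c : Fin n → Bool) (g : Fin n → ℤ) (d : Fin n) →
  ΣF n (λ v → if c v then g v else + 0)
    ≡ ΣF n (λ v → if c v ∧ not (v == d) then g v else + 0) + (if c d then g d else + 0)
ΣF-split {n} c g d =
  trans (ΣF-cong n split)
        (trans (ΣF-+ n _ _) (cong (_+_ (ΣF n (λ v → if c v ∧ not (v == d) then g v else + 0)))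
                                  (ΣF-delta n d (λ v → if c v then g v else + 0))))
  where
  split : ∀ v → (if c v then g v else + 0)
              ≡ (if c v ∧ not (v == d) then g v else + 0) + (if v == d then (if c v then g v else + 0) else + 0)
  split v with c v | v == d
  ... | true  | true  = sym (ℤP.+-identityˡ _)
  ... | true  | false = sym (ℤP.+-identityʳ _)
  ... | false | true  = refl
  ... | false | false = refl

Σ< : ℕ → (ℕ → ℤ) → ℤ
Σ< zero    f = + 0
Σ< (suc K) f = f 0 + Σ< K (λ k → f (suc k))

Σ<-cong : ∀ K {f g : ℕ → ℤ} → (∀ k → f k ≡ g k) → Σ< K f ≡ Σ< K g
Σ<-cong zero    f≗g = refl
Σ<-cong (suc K) f≗g = cong₂ _+_ (f≗g 0) (Σ<-cong K (λ k → f≗g (suc k)))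

Σ<-zero : ∀ K → Σ< K (λ _ → + 0) ≡ + 0
Σ<-zero zero    = refl
Σ<-zero (suc K) = trans (ℤP.+-identityˡ _) (Σ<-zero K)

Σ<-+ : ∀ K (f g : ℕ → ℤ) → Σ< K (λ k → f k + g k) ≡ Σ< K f + Σ< K g
Σ<-+ zero    f g = refl
Σ<-+ (suc K) f g =
  trans (cong (_+_ (f 0 + g 0)) (Σ<-+ K (λ k → f (suc k)) (λ k → g (suc k)))) (interchange (f 0) (g 0) _ _)

Σ<-delta : ∀ K j (c : ℕ → ℤ) → Σ< K (λ k → if j ≡ᵇ k then c k else + 0) ≡ (if j <ᵇ K then c j else + 0)
Σ<-delta zero    j       c = refl
Σ<-delta (suc K) zero    c = trans (cong (_+_ (c 0)) (Σ<-zero K)) (ℤP.+-identityʳ _)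
Σ<-delta (suc K) (suc j) c = trans (ℤP.+-identityˡ _) (Σ<-delta K j (λ k → c (suc k)))

Σ<-upTo : ∀ K (f : ℕ → ℤ) → ΣL f (upTo K) ≡ Σ< K f
Σ<-upTo K f = go K (λ k → k)
  where
  go : ∀ K (g : ℕ → ℕ) → ΣL f (applyUpTo g K) ≡ Σ< K (λ k → f (g k))
  go zero    g = refl
  go (suc K) g = cong (_+_ (f (g 0))) (go K (λ k → g (suc k)))

-- f = a + x·g gives f(1) = a + g(1) and f′(1) = g(1) + g′(1).
eval1 : Poly → ℤ
eval1 []      = + 0
eval1 (a ∷ f) = a + eval1 f

deriv1 : Poly → ℤ
deriv1 []      = + 0
deriv1 (a ∷ f) = eval1 f + deriv1 f

eval1-+P : ∀ f g → eval1 (f +P g) ≡ eval1 f + eval1 g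
eval1-+P []      g       = sym (ℤP.+-identityˡ _)
eval1-+P (a ∷ f) []      = sym (ℤP.+-identityʳ _)
eval1-+P (a ∷ f) (b ∷ g) = trans (cong (_+_ (a + b)) (eval1-+P f g)) (interchange a b _ _)

deriv1-+P : ∀ f g → deriv1 (f +P g) ≡ deriv1 f + deriv1 g
deriv1-+P []      g       = sym (ℤP.+-identityˡ _)
deriv1-+P (a ∷ f) []      = sym (ℤP.+-identityʳ _)
deriv1-+P (a ∷ f) (b ∷ g) =
  trans (cong₂ _+_ (eval1-+P f g) (deriv1-+P f g)) (interchange (eval1 f) (eval1 g) _ _)

eval1-scale : ∀ c f → eval1 (map (c *_) f) ≡ c * eval1 f
eval1-scale c []      = sym (ℤP.*-zeroʳ c)
eval1-scale c (a ∷ f) = trans (cong (_+_ (c * a)) (eval1-scale c f)) (sym (ℤP.*-distribˡ-+ c a _))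

deriv1-scale : ∀ c f → deriv1 (map (c *_) f) ≡ c * deriv1 f
deriv1-scale c []      = sym (ℤP.*-zeroʳ c)
deriv1-scale c (a ∷ f) =
  trans (cong₂ _+_ (eval1-scale c f) (deriv1-scale c f)) (sym (ℤP.*-distribˡ-+ c (eval1 f) _))

eval1-*P : ∀ f g → eval1 (f *P g) ≡ eval1 f * eval1 g
eval1-*P []      g = refl
eval1-*P (a ∷ f) g = begin
  eval1 (map (a *_) g +P (+ 0 ∷ (f *P g)))     ≡⟨ eval1-+P (map (a *_) g) _ ⟩
  eval1 (map (a *_) g) + (+ 0 + eval1 (f *P g)) ≡⟨ cong₂ (λ x y → x + (+ 0 + y)) (eval1-scale a g) (eval1-*P f g) ⟩
  a * eval1 g + (+ 0 + eval1 f * eval1 g)       ≡⟨ regroup a (eval1 f) (eval1 g) ⟩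
  (a + eval1 f) * eval1 g                       ∎
  where
  open ≡-Reasoning
  regroup : ∀ a x y → a * y + (+ 0 + x * y) ≡ (a + x) * y
  regroup = solve-∀

deriv1-*P : ∀ f g → deriv1 (f *P g) ≡ deriv1 f * eval1 g + eval1 f * deriv1 g
deriv1-*P []      g = refl
deriv1-*P (a ∷ f) g = begin
  deriv1 (map (a *_) g +P (+ 0 ∷ (f *P g)))
    ≡⟨ deriv1-+P (map (a *_) g) _ ⟩
  deriv1 (map (a *_) g) + (eval1 (f *P g) + deriv1 (f *P g))
    ≡⟨ cong₂ (λ x y → x + y) (deriv1-scale a g) (cong₂ _+_ (eval1-*P f g) (deriv1-*P f g)) ⟩
  a * deriv1 g + (eval1 f * eval1 g + (deriv1 f * eval1 g + eval1 f * deriv1 g))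
    ≡⟨ regroup a (eval1 f) (deriv1 f) (eval1 g) (deriv1 g) ⟩
  (eval1 f + deriv1 f) * eval1 g + (a + eval1 f) * deriv1 g ∎
  where
  open ≡-Reasoning
  regroup : ∀ a x x′ y y′ → a * y′ + (x * y + (x′ * y + x * y′)) ≡ (x + x′) * y + (a + x) * y′
  regroup = solve-∀

coeff-+P : ∀ f g i → coeff (f +P g) i ≡ coeff f i + coeff g i
coeff-+P []      g       i       = sym (ℤP.+-identityˡ _)
coeff-+P (a ∷ f) []      i       = sym (ℤP.+-identityʳ _)
coeff-+P (a ∷ f) (b ∷ g) zero    = refl
coeff-+P (a ∷ f) (b ∷ g) (suc i) = coeff-+P f g i

coeff-scale : ∀ c f i → coeff (map (c *_) f) i ≡ c * coeff f i
coeff-scale c []      i       = sym (ℤP.*-zeroʳ c)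
coeff-scale c (a ∷ f) zero    = refl
coeff-scale c (a ∷ f) (suc i) = coeff-scale c f i

coeff-[0] : ∀ i → coeff (+ 0 ∷ []) i ≡ + 0
coeff-[0] zero    = refl
coeff-[0] (suc i) = refl

eval1-deriv1-zero : ∀ f → (∀ i → coeff f i ≡ + 0) → eval1 f ≡ + 0 × deriv1 f ≡ + 0
eval1-deriv1-zero []      _    = refl , refl
eval1-deriv1-zero (a ∷ f) f≈0 with eval1-deriv1-zero f (λ i → f≈0 (suc i))
... | e , d rewrite f≈0 0 | e | d = refl , refl

eval1-deriv1-coeff : ∀ f g → (∀ i → coeff f i ≡ coeff g i) → eval1 f ≡ eval1 g × deriv1 f ≡ deriv1 g
eval1-deriv1-coeff []      g       f≈g with eval1-deriv1-zero g (λ i → sym (f≈g i))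
... | e , d = sym e , sym d
eval1-deriv1-coeff (a ∷ f) []      f≈g = eval1-deriv1-zero (a ∷ f) f≈g
eval1-deriv1-coeff (a ∷ f) (b ∷ g) f≈g with eval1-deriv1-coeff f g (λ i → f≈g (suc i))
... | e , d rewrite f≈g 0 | e | d = refl , refl

[x-1]⁰∣ : ∀ f → (x-1 ^P 0) ∣P f
[x-1]⁰∣ f = f , λ i → sym (begin
  coeff (map (+ 1 *_) f +P (+ 0 ∷ [])) i ≡⟨ coeff-+P (map (+ 1 *_) f) _ i ⟩
  coeff (map (+ 1 *_) f) i + coeff (+ 0 ∷ []) i ≡⟨ cong₂ _+_ (coeff-scale (+ 1) f i) (coeff-[0] i) ⟩
  + 1 * coeff f i + + 0 ≡⟨ trans (ℤP.+-identityʳ _) (ℤP.*-identityˡ _) ⟩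
  coeff f i ∎)
  where open ≡-Reasoning

eval1≢0⇒[x-1]∤ : ∀ f → eval1 f ≢ + 0 → ¬ ((x-1 ^P 1) ∣P f)
eval1≢0⇒[x-1]∤ f f[1]≢0 (q , f≈) = f[1]≢0 (begin
  eval1 f                   ≡⟨ proj₁ (eval1-deriv1-coeff f ((x-1 ^P 1) *P q) f≈) ⟩
  eval1 ((x-1 ^P 1) *P q)   ≡⟨ eval1-*P (x-1 ^P 1) q ⟩
  + 0 * eval1 q             ≡⟨ ℤP.*-zeroˡ (eval1 q) ⟩
  + 0                       ∎)
  where open ≡-Reasoning

deriv1≢0⇒[x-1]²∤ : ∀ f → deriv1 f ≢ + 0 → ¬ ((x-1 ^P 2) ∣P f)
deriv1≢0⇒[x-1]²∤ f f′[1]≢0 (q , f≈) = f′[1]≢0 (begin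
  deriv1 f                                  ≡⟨ proj₂ (eval1-deriv1-coeff f ((x-1 ^P 2) *P q) f≈) ⟩
  deriv1 ((x-1 ^P 2) *P q)                  ≡⟨ deriv1-*P (x-1 ^P 2) q ⟩
  + 0 * eval1 q + + 0 * deriv1 q            ≡⟨ cong₂ _+_ (ℤP.*-zeroˡ (eval1 q)) (ℤP.*-zeroˡ (deriv1 q)) ⟩
  + 0                                       ∎)
  where open ≡-Reasoning

-- The quotient of f by x - 1 when f(1) = 0 (synthetic division).
tailSums : Poly → Poly
tailSums []      = []
tailSums (a ∷ f) = eval1 f ∷ tailSums f

coeff-tailSums : ∀ f i → coeff (tailSums f) i ≡ eval1 (drop (suc i) f)
coeff-tailSums []      i       = refl
coeff-tailSums (a ∷ f) zero    = refl
coeff-tailSums (a ∷ f) (suc i) = coeff-tailSums f i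

eval1-drop : ∀ f i → eval1 (drop i f) ≡ coeff f i + eval1 (drop (suc i) f)
eval1-drop []      zero    = refl
eval1-drop []      (suc i) = refl
eval1-drop (a ∷ f) zero    = refl
eval1-drop (a ∷ f) (suc i) = eval1-drop f i

coeff-[x-1]*-zero : ∀ q → coeff ((x-1 ^P 1) *P q) 0 ≡ - coeff q 0
coeff-[x-1]*-zero q = begin
  coeff ((x-1 ^P 1) *P q) 0                               ≡⟨ coeff-+P (map (- + 1 *_) q) _ 0 ⟩
  coeff (map (- + 1 *_) q) 0 + + 0                        ≡⟨ cong (_+ + 0) (coeff-scale (- + 1) q 0) ⟩
  - + 1 * coeff q 0 + + 0                                 ≡⟨ trans (ℤP.+-identityʳ _) (ℤP.-1*i≡-i _) ⟩
  - coeff q 0                                             ∎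
  where open ≡-Reasoning

coeff-[x-1]*-suc : ∀ q i → coeff ((x-1 ^P 1) *P q) (suc i) ≡ coeff q i - coeff q (suc i)
coeff-[x-1]*-suc q i = begin
  coeff ((x-1 ^P 1) *P q) (suc i)
    ≡⟨ coeff-+P (map (- + 1 *_) q) _ (suc i) ⟩
  coeff (map (- + 1 *_) q) (suc i) + coeff (map (+ 1 *_) q +P (+ 0 ∷ [])) i
    ≡⟨ cong₂ _+_ (coeff-scale (- + 1) q (suc i)) (coeff-+P (map (+ 1 *_) q) _ i) ⟩
  - + 1 * coeff q (suc i) + (coeff (map (+ 1 *_) q) i + coeff (+ 0 ∷ []) i)
    ≡⟨ cong₂ (λ x y → - + 1 * coeff q (suc i) + (x + y)) (coeff-scale (+ 1) q i) (coeff-[0] i) ⟩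
  - + 1 * coeff q (suc i) + (+ 1 * coeff q i + + 0)
    ≡⟨ regroup (coeff q i) (coeff q (suc i)) ⟩
  coeff q i - coeff q (suc i) ∎
  where
  open ≡-Reasoning
  regroup : ∀ x y → - + 1 * y + (+ 1 * x + + 0) ≡ x - y
  regroup = solve-∀

eval1≡0⇒[x-1]∣ : ∀ f → eval1 f ≡ + 0 → (x-1 ^P 1) ∣P f
eval1≡0⇒[x-1]∣ f f[1]≡0 = tailSums f , f≈
  where
  f≈ : ∀ i → coeff f i ≡ coeff ((x-1 ^P 1) *P tailSums f) i
  f≈ zero = sym (begin
    coeff ((x-1 ^P 1) *P tailSums f) 0 ≡⟨ trans (coeff-[x-1]*-zero (tailSums f)) (cong -_ (coeff-tailSums f 0)) ⟩
    - eval1 (drop 1 f)                 ≡⟨ regroup (coeff f 0) (eval1 (drop 1 f)) ⟩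
    coeff f 0 - (coeff f 0 + eval1 (drop 1 f)) ≡⟨ cong (_-_ (coeff f 0)) (trans (sym (eval1-drop f 0)) f[1]≡0) ⟩
    coeff f 0 - + 0                    ≡⟨ ℤP.+-identityʳ _ ⟩
    coeff f 0                          ∎)
    where
    open ≡-Reasoning
    regroup : ∀ c r → - r ≡ c - (c + r)
    regroup = solve-∀
  f≈ (suc i) = sym (begin
    coeff ((x-1 ^P 1) *P tailSums f) (suc i)   ≡⟨ coeff-[x-1]*-suc (tailSums f) i ⟩
    coeff (tailSums f) i - coeff (tailSums f) (suc i)
      ≡⟨ cong₂ _-_ (trans (coeff-tailSums f i) (eval1-drop f (suc i))) (coeff-tailSums f (suc i)) ⟩
    coeff f (suc i) + eval1 (drop (2 ℕ.+ i) f) - eval1 (drop (2 ℕ.+ i) f) ≡⟨ regroup (coeff f (suc i)) _ ⟩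
    coeff f (suc i) ∎)
    where
    open ≡-Reasoning
    regroup : ∀ c r → c + r - r ≡ c
    regroup = solve-∀

Edge : ℕ → Set
Edge m = Fin m × Fin m

touches : Fin m → Edge m → Bool
touches u e = proj₁ e == u ∨ proj₂ e == u

avoids : Fin m → Edge m → Bool
avoids u e = not (touches u e)

NonLoop : Edge m → Set
NonLoop e = (proj₁ e == proj₂ e) ≡ false

disjointᵇ-avoids : (a b : Fin m) (e : Edge m) → disjointᵇ (a , b) e ≡ (avoids a e ∧ avoids b e)
disjointᵇ-avoids a b (c , d)
  rewrite isYes-≟ a c | isYes-≟ a d | isYes-≟ b c | isYes-≟ b d
        | ==-sym a c | ==-sym a d | ==-sym b c | ==-sym b d =
  trans (cong not (sym (BP.∨-assoc (c == a) (d == a) _))) (deMorgan₂ (c == a ∨ d == a) (c == b ∨ d == b))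

disjoint⇒avoids₁ : (a b : Fin m) (e : Edge m) → disjointᵇ (a , b) e ≡ true → avoids a e ≡ true
disjoint⇒avoids₁ a b e disj = proj₁ (∧-true (trans (sym (disjointᵇ-avoids a b e)) disj))

disjoint⇒avoids₂ : (a b : Fin m) (e : Edge m) → disjointᵇ (a , b) e ≡ true → avoids b e ≡ true
disjoint⇒avoids₂ a b e disj = proj₂ (∧-true (trans (sym (disjointᵇ-avoids a b e)) disj))

disjointᵇ-self : (e : Edge m) → disjointᵇ e e ≡ false
disjointᵇ-self (a , b) rewrite disjointᵇ-avoids a b (a , b) | ==-refl a = refl

disjointᵇ-sym : (e e′ : Edge m) → disjointᵇ e e′ ≡ disjointᵇ e′ e
disjointᵇ-sym (a , b) (c , d)
  rewrite isYes-≟ a c | isYes-≟ a d | isYes-≟ b c | isYes-≟ b d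
        | isYes-≟ c a | isYes-≟ c b | isYes-≟ d a | isYes-≟ d b
        | ==-sym c a | ==-sym c b | ==-sym d a | ==-sym d b =
  cong not (∨-Solver.solve 4 (λ x y z w → x ⊕ (y ⊕ (z ⊕ w)) ⊜ x ⊕ (z ⊕ (y ⊕ w))) refl
                            (a == c) (a == d) (b == c) (b == d))
  where open ∨-Solver

touches⇒¬disjoint : (u : Fin m) (e e′ : Edge m) → touches u e ≡ true → touches u e′ ≡ true →
                    disjointᵇ e e′ ≡ false
touches⇒¬disjoint u (a , b) e′ ue ue′ = trans (disjointᵇ-avoids a b e′) (either (∨-true ue))
  where
  ¬avoids : ∀ {v} → (v == u) ≡ true → avoids v e′ ≡ false
  ¬avoids v==u = subst (λ v → avoids v e′ ≡ false) (sym (==⇒≡ v==u)) (cong not ue′)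
  either : (a == u) ≡ true ⊎ (b == u) ≡ true → (avoids a e′ ∧ avoids b e′) ≡ false
  either (inj₁ a==u) = cong (_∧ avoids b e′) (¬avoids a==u)
  either (inj₂ b==u) = trans (cong (avoids a e′ ∧_) (¬avoids b==u)) (BP.∧-zeroʳ _)

matchingSign : List (Edge m) → ℤ
matchingSign M = if isMatchingᵇ M then sign (length M) else + 0

signedMatchings : List (Edge m) → ℤ
signedMatchings L = ΣL matchingSign (sublists L)

ΣL-sublists-∷ : (f : List A → ℤ) (x : A) (L : List A) →
                ΣL f (sublists (x ∷ L)) ≡ ΣL (λ M → f (x ∷ M)) (sublists L) + ΣL f (sublists L)
ΣL-sublists-∷ f x L =
  trans (ΣL-++ f (map (x ∷_) (sublists L)) (sublists L))
        (cong (_+ ΣL f (sublists L)) (ΣL-map f (x ∷_) (sublists L)))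

ΣL-sublists-cong : (P : A → Set) {f g : List A → ℤ} → (∀ M → All P M → f M ≡ g M) →
                   ∀ L → All P L → ΣL f (sublists L) ≡ ΣL g (sublists L)
ΣL-sublists-cong P f≗g []      []         = cong (_+ + 0) (f≗g [] [])
ΣL-sublists-cong P {f} {g} f≗g (x ∷ L) (px ∷ pL) =
  trans (ΣL-sublists-∷ f x L)
    (trans (cong₂ _+_ (ΣL-sublists-cong P (λ M pM → f≗g (x ∷ M) (px ∷ pM)) L pL)
                      (ΣL-sublists-cong P f≗g L pL))
           (sym (ΣL-sublists-∷ g x L)))

ΣL-sublists-filterᵇ : (p : A → Bool) (g : List A → ℤ) (L : List A) →
  ΣL (λ M → if allᵇ p M then g M else + 0) (sublists L) ≡ ΣL g (sublists (filterᵇ p L))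
ΣL-sublists-filterᵇ p g []      = refl
ΣL-sublists-filterᵇ p g (x ∷ L)
  rewrite ΣL-sublists-∷ (λ M → if allᵇ p M then g M else + 0) x L with p x
... | true  = trans (cong₂ _+_ (ΣL-sublists-filterᵇ p (λ M → g (x ∷ M)) L) (ΣL-sublists-filterᵇ p g L))
                    (sym (ΣL-sublists-∷ g x (filterᵇ p L)))
... | false = trans (cong₂ _+_ (ΣL-zero (sublists L)) refl)
                    (trans (ℤP.+-identityˡ _) (ΣL-sublists-filterᵇ p g L))

-- A matching containing e is e together with a matching of the edges disjoint from e.
signedMatchings-∷ : (e : Edge m) (L : List (Edge m)) →
  signedMatchings (e ∷ L) ≡ signedMatchings L - signedMatchings (filterᵇ (disjointᵇ e) L)
signedMatchings-∷ e L = begin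
  signedMatchings (e ∷ L)
    ≡⟨ ΣL-sublists-∷ matchingSign e L ⟩
  ΣL (λ M → matchingSign (e ∷ M)) (sublists L) + signedMatchings L
    ≡⟨ cong (_+ signedMatchings L) (ΣL-cong sign-∷ (sublists L)) ⟩
  ΣL (λ M → if allᵇ (disjointᵇ e) M then - matchingSign M else + 0) (sublists L) + signedMatchings L
    ≡⟨ cong (_+ signedMatchings L) (ΣL-sublists-filterᵇ (disjointᵇ e) (λ M → - matchingSign M) L) ⟩
  ΣL (λ M → - matchingSign M) (sublists (filterᵇ (disjointᵇ e) L)) + signedMatchings L
    ≡⟨ cong (_+ signedMatchings L) (ΣL-neg matchingSign (sublists (filterᵇ (disjointᵇ e) L))) ⟩
  - signedMatchings (filterᵇ (disjointᵇ e) L) + signedMatchings L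
    ≡⟨ ℤP.+-comm _ (signedMatchings L) ⟩
  signedMatchings L - signedMatchings (filterᵇ (disjointᵇ e) L) ∎
  where
  open ≡-Reasoning
  sign-∷ : ∀ M → matchingSign (e ∷ M) ≡ (if allᵇ (disjointᵇ e) M then - matchingSign M else + 0)
  sign-∷ M with allᵇ (disjointᵇ e) M | isMatchingᵇ M
  ... | true  | true  = refl
  ... | true  | false = refl
  ... | false | _     = refl

#uncovered : List (Edge m) → ℕ
#uncovered {m} M = countF m (λ u → allᵇ (avoids u) M)

#uncovered+2|M|≡m : (M : List (Edge m)) → All NonLoop M → isMatchingᵇ M ≡ true →
                    #uncovered M ℕ.+ (length M ℕ.+ length M) ≡ m
#uncovered+2|M|≡m {m} []            _            _     = trans (ℕP.+-identityʳ _) (countF-true m)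
#uncovered+2|M|≡m {m} ((a , b) ∷ M) (a≢b ∷ loopless) match
  with disj , match′ ← ∧-true {allᵇ (disjointᵇ (a , b)) M} match = begin
  #uncovered ((a , b) ∷ M) ℕ.+ (suc l ℕ.+ suc l)
    ≡⟨ cong (ℕ._+ (suc l ℕ.+ suc l)) (countF-cong m (λ u → not-∨-∧ (a == u) (b == u) (Q u))) ⟩
  countF m (λ u → not (b == u) ∧ Q′ u) ℕ.+ (suc l ℕ.+ suc l)
    ≡⟨ regroup (countF m (λ u → not (b == u) ∧ Q′ u)) l ⟩
  countF m (λ u → not (b == u) ∧ Q′ u) ℕ.+ 1 ℕ.+ 1 ℕ.+ (l ℕ.+ l)
    ≡⟨ cong (λ t → t ℕ.+ 1 ℕ.+ (l ℕ.+ l)) (countF-remove m b Q′ Q′b) ⟩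
  countF m Q′ ℕ.+ 1 ℕ.+ (l ℕ.+ l)
    ≡⟨ cong (ℕ._+ (l ℕ.+ l)) (countF-remove m a Q Qa) ⟩
  countF m Q ℕ.+ (l ℕ.+ l)
    ≡⟨ #uncovered+2|M|≡m M loopless match′ ⟩
  m ∎
  where
  open ≡-Reasoning
  l = length M
  Q Q′ : Fin m → Bool
  Q u  = allᵇ (avoids u) M
  Q′ u = not (a == u) ∧ Q u
  regroup : ∀ c l → c ℕ.+ (suc l ℕ.+ suc l) ≡ c ℕ.+ 1 ℕ.+ 1 ℕ.+ (l ℕ.+ l)
  regroup = ℕSolver.solve-∀
  Qa : Q a ≡ true
  Qa = allᵇ-mono (disjointᵇ (a , b)) (avoids a) (disjoint⇒avoids₁ a b) M disj
  Q′b : Q′ b ≡ true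
  Q′b rewrite a≢b =
    allᵇ-mono (disjointᵇ (a , b)) (avoids b) (disjoint⇒avoids₂ a b) M disj

allPairs : ∀ m → List (Edge m)
allPairs m = concatMap (λ i → map (i ,_) (allFin m)) (allFin m)

matching-size-bound : (M : List (Edge m)) → All NonLoop M → isMatchingᵇ M ≡ true →
                      (length M <ᵇ suc ⌊ m /2⌋) ≡ true
matching-size-bound {m} M loopless match =
  <⇒<ᵇ-true (s≤s (subst (_≤ ⌊ m /2⌋) (sym (ℕP.n≡⌊n+n/2⌋ (length M))) (ℕP.⌊n/2⌋-mono 2|M|≤m)))
  where
  2|M|≤m : length M ℕ.+ length M ≤ m
  2|M|≤m = subst (length M ℕ.+ length M ≤_) (#uncovered+2|M|≡m M loopless match)
                 (ℕP.m≤n+m _ (#uncovered M))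

edges-NonLoop : (G : Graph m) → All NonLoop (edges G)
edges-NonLoop {m} G =
  All.map (λ {e} → nonLoop (proj₁ e) (proj₂ e) (adj G (proj₁ e) (proj₂ e))) (all-filterᵇ _ (allPairs m))
  where
  nonLoop : (i j : Fin m) (b : Bool) → ((toℕ i <ᵇ toℕ j) ∧ b) ≡ true → (i == j) ≡ false
  nonLoop i j b i<j∧b with i == j in i==j
  ... | false = refl
  ... | true with refl ← ==⇒≡ {i = i} {j} i==j =
    ⊥-elim (ℕP.<-irrefl refl (<ᵇ-true⇒< {toℕ i} (proj₁ (∧-true i<j∧b))))

#matchings : List (List (Edge m)) → ℕ → ℕ
#matchings Ms k = length (filterᵇ (λ M → isMatchingᵇ M ∧ (length M ≡ᵇ k)) Ms)

Σ<-#matchings : (c : ℕ → ℤ) (K : ℕ) (Ms : List (List (Edge m))) →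
  Σ< K (λ k → c k * + #matchings Ms k)
    ≡ ΣL (λ M → if isMatchingᵇ M then (if length M <ᵇ K then c (length M) else + 0) else + 0) Ms
Σ<-#matchings c K []       = trans (Σ<-cong K (λ k → ℤP.*-zeroʳ (c k))) (Σ<-zero K)
Σ<-#matchings c K (M ∷ Ms) =
  trans (Σ<-cong K split) (trans (Σ<-+ K _ _) (cong₂ _+_ head (Σ<-#matchings c K Ms)))
  where
  split : ∀ k → c k * + #matchings (M ∷ Ms) k
              ≡ (if isMatchingᵇ M then (if length M ≡ᵇ k then c k else + 0) else + 0) + c k * + #matchings Ms k
  split k with isMatchingᵇ M | length M ≡ᵇ k
  ... | true  | true  = trans (ℤP.*-distribˡ-+ (c k) (+ 1) _) (cong₂ _+_ (ℤP.*-identityʳ (c k)) refl)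
  ... | true  | false = sym (ℤP.+-identityˡ _)
  ... | false | _     = sym (ℤP.+-identityˡ _)
  head : Σ< K (λ k → if isMatchingᵇ M then (if length M ≡ᵇ k then c k else + 0) else + 0)
         ≡ (if isMatchingᵇ M then (if length M <ᵇ K then c (length M) else + 0) else + 0)
  head with isMatchingᵇ M
  ... | true  = Σ<-delta K (length M) c
  ... | false = Σ<-zero K

eval1-foldr : (ps : List Poly) → eval1 (foldr _+P_ [] ps) ≡ ΣL eval1 ps
eval1-foldr []       = refl
eval1-foldr (f ∷ ps) = trans (eval1-+P f _) (cong (_+_ (eval1 f)) (eval1-foldr ps))

deriv1-foldr : (ps : List Poly) → deriv1 (foldr _+P_ [] ps) ≡ ΣL deriv1 ps
deriv1-foldr []       = refl
deriv1-foldr (f ∷ ps) = trans (deriv1-+P f _) (cong (_+_ (deriv1 f)) (deriv1-foldr ps))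

eval1-monomial : ∀ d c → eval1 (monomial d c) ≡ c
eval1-monomial zero    c = ℤP.+-identityʳ c
eval1-monomial (suc d) c = trans (ℤP.+-identityˡ _) (eval1-monomial d c)

deriv1-monomial : ∀ d c → deriv1 (monomial d c) ≡ + d * c
deriv1-monomial zero    c = sym (ℤP.*-zeroˡ c)
deriv1-monomial (suc d) c = begin
  eval1 (monomial d c) + deriv1 (monomial d c) ≡⟨ cong₂ _+_ (eval1-monomial d c) (deriv1-monomial d c) ⟩
  c + + d * c                                  ≡⟨ cong (_+ + d * c) (ℤP.*-identityˡ c) ⟨
  + 1 * c + + d * c                            ≡⟨ ℤP.*-distribʳ-+ c (+ 1) (+ d) ⟨
  + suc d * c                                  ∎
  where open ≡-Reasoning

eval1-μ : (G : Graph n) → eval1 (μ G) ≡ Σ< (suc ⌊ n /2⌋) (λ k → sign k * + p G k)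
eval1-μ {n} G = begin
  eval1 (μ G)                         ≡⟨ eval1-foldr (map term ks) ⟩
  ΣL eval1 (map term ks)              ≡⟨ ΣL-map eval1 term ks ⟩
  ΣL (λ k → eval1 (term k)) ks        ≡⟨ ΣL-cong (λ k → eval1-monomial (n ∸ (k ℕ.+ k)) _) ks ⟩
  ΣL (λ k → sign k * + p G k) ks      ≡⟨ Σ<-upTo (suc ⌊ n /2⌋) (λ k → sign k * + p G k) ⟩
  Σ< (suc ⌊ n /2⌋) (λ k → sign k * + p G k) ∎
  where
  open ≡-Reasoning
  ks = upTo (suc ⌊ n /2⌋)
  term : ℕ → Poly
  term k = monomial (n ∸ (k ℕ.+ k)) (sign k * + p G k)

deriv1-μ : (G : Graph n) → deriv1 (μ G) ≡ Σ< (suc ⌊ n /2⌋) (λ k → (+ (n ∸ (k ℕ.+ k)) * sign k) * + p G k)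
deriv1-μ {n} G = begin
  deriv1 (μ G)                        ≡⟨ deriv1-foldr (map term ks) ⟩
  ΣL deriv1 (map term ks)             ≡⟨ ΣL-map deriv1 term ks ⟩
  ΣL (λ k → deriv1 (term k)) ks       ≡⟨ ΣL-cong deriv1-term ks ⟩
  ΣL weight ks                        ≡⟨ Σ<-upTo (suc ⌊ n /2⌋) weight ⟩
  Σ< (suc ⌊ n /2⌋) weight             ∎
  where
  open ≡-Reasoning
  ks = upTo (suc ⌊ n /2⌋)
  term : ℕ → Poly
  term k = monomial (n ∸ (k ℕ.+ k)) (sign k * + p G k)
  weight : ℕ → ℤ
  weight k = (+ (n ∸ (k ℕ.+ k)) * sign k) * + p G k
  deriv1-term : ∀ k → deriv1 (term k) ≡ weight k
  deriv1-term k = trans (deriv1-monomial (n ∸ (k ℕ.+ k)) _) (sym (ℤP.*-assoc (+ (n ∸ (k ℕ.+ k))) (sign k) _))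

uncoveredSign : ℕ → List (Edge m) → ℤ
uncoveredSign n M = if isMatchingᵇ M then + (n ∸ (length M ℕ.+ length M)) * sign (length M) else + 0

-- The sum defining μ stops at k = ⌊ n /2⌋; no matching is larger.
Σ<-matchings : (c : ℕ → ℤ) (G : Graph n) →
  Σ< (suc ⌊ n /2⌋) (λ k → c k * + p G k) ≡ ΣL (λ M → if isMatchingᵇ M then c (length M) else + 0) (sublists (edges G))
Σ<-matchings {n} c G =
  trans (Σ<-#matchings c (suc ⌊ n /2⌋) (sublists (edges G))) (ΣL-sublists-cong NonLoop bounded (edges G) (edges-NonLoop G))
  where
  bounded : ∀ M → All NonLoop M →
            (if isMatchingᵇ M then (if length M <ᵇ suc ⌊ n /2⌋ then c (length M) else + 0) else + 0)
              ≡ (if isMatchingᵇ M then c (length M) else + 0)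
  bounded M loopless with isMatchingᵇ M in match
  ... | true  = cong (λ b → if b then c (length M) else + 0) (matching-size-bound M loopless match)
  ... | false = refl

eval1-μ≡signedMatchings : (G : Graph n) → eval1 (μ G) ≡ signedMatchings (edges G)
eval1-μ≡signedMatchings G = trans (eval1-μ G) (Σ<-matchings sign G)

deriv1-μ≡ΣuncoveredSign : (G : Graph n) → deriv1 (μ G) ≡ ΣL (uncoveredSign n) (sublists (edges G))
deriv1-μ≡ΣuncoveredSign {n} G = trans (deriv1-μ G) (Σ<-matchings (λ k → + (n ∸ (k ℕ.+ k)) * sign k) G)

-- Each matching is counted once for each vertex it leaves uncovered.
ΣF-signedMatchings-avoiding : (L : List (Edge m)) → All NonLoop L →
  ΣF m (λ u → signedMatchings (filterᵇ (avoids u) L)) ≡ ΣL (uncoveredSign m) (sublists L)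
ΣF-signedMatchings-avoiding {m} L loopless = begin
  ΣF m (λ u → signedMatchings (filterᵇ (avoids u) L))
    ≡⟨ ΣF-cong m (λ u → sym (ΣL-sublists-filterᵇ (avoids u) matchingSign L)) ⟩
  ΣF m (λ u → ΣL (λ M → if allᵇ (avoids u) M then matchingSign M else + 0) (sublists L))
    ≡⟨ ΣF-ΣL m (λ u M → if allᵇ (avoids u) M then matchingSign M else + 0) (sublists L) ⟩
  ΣL (λ M → ΣF m (λ u → if allᵇ (avoids u) M then matchingSign M else + 0)) (sublists L)
    ≡⟨ ΣL-sublists-cong NonLoop perMatching L loopless ⟩
  ΣL (uncoveredSign m) (sublists L) ∎
  where
  open ≡-Reasoning
  perMatching : ∀ M → All NonLoop M →
                ΣF m (λ u → if allᵇ (avoids u) M then matchingSign M else + 0) ≡ uncoveredSign m M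
  perMatching M loopless′ rewrite ΣF-indicator m (λ u → allᵇ (avoids u) M) (matchingSign M)
    with isMatchingᵇ M in match
  ... | true  = cong (λ k → + k * sign (length M))
                     (sym (trans (cong (_∸ (length M ℕ.+ length M)) (sym (#uncovered+2|M|≡m M loopless′ match)))
                                 (ℕP.m+n∸n≡m (#uncovered M) (length M ℕ.+ length M))))
  ... | false = ℤP.*-zeroʳ (+ #uncovered M)

-- The vertex recurrence μ(G) = μ(G ∖ u) - Σ_{v ~ u} μ(G ∖ u ∖ v) at x = 1, on edge lists

module _ {m} (u : Fin m) where
  private
    Z : List (Edge m) → ℤ
    Z = signedMatchings
    _∖ₑ_ : List (Edge m) → Edge m → List (Edge m)
    L ∖ₑ e = filterᵇ (disjointᵇ e) L

  Σ-touching : List (Edge m) → ℤ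
  Σ-touching L = ΣL (λ e → Z (L ∖ₑ e)) (filterᵇ (touches u) L)

  VertexRecurrence : List (Edge m) → Set
  VertexRecurrence L = Z L ≡ Z (filterᵇ (avoids u) L) - Σ-touching L

  vertexRecurrence-touching : (e : Edge m) (L : List (Edge m)) → touches u e ≡ true → VertexRecurrence L →
    Z (e ∷ L) ≡ Z (filterᵇ (avoids u) L)
                - (Z ((e ∷ L) ∖ₑ e) + ΣL (λ e′ → Z ((e ∷ L) ∖ₑ e′)) (filterᵇ (touches u) L))
  vertexRecurrence-touching e L ue rec = begin
    Z (e ∷ L)                                  ≡⟨ signedMatchings-∷ e L ⟩
    Z L - Z (L ∖ₑ e)                           ≡⟨ cong (_- Z (L ∖ₑ e)) rec ⟩
    Z Lᵤ - Σ-touching L - Z (L ∖ₑ e)           ≡⟨ regroup (Z Lᵤ) (Σ-touching L) (Z (L ∖ₑ e)) ⟩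
    Z Lᵤ - (Z (L ∖ₑ e) + Σ-touching L)         ≡⟨ cong₂ (λ x y → Z Lᵤ - (x + y)) drop-e drop-touching ⟩
    Z Lᵤ - (Z ((e ∷ L) ∖ₑ e) + ΣL (λ e′ → Z ((e ∷ L) ∖ₑ e′)) (filterᵇ (touches u) L)) ∎
    where
    open ≡-Reasoning
    Lᵤ = filterᵇ (avoids u) L
    regroup : ∀ a s z → a - s - z ≡ a - (z + s)
    regroup = solve-∀
    drop-e : Z (L ∖ₑ e) ≡ Z ((e ∷ L) ∖ₑ e)
    drop-e = cong Z (sym (filterᵇ-reject (disjointᵇ e) L (disjointᵇ-self e)))
    drop-touching : Σ-touching L ≡ ΣL (λ e′ → Z ((e ∷ L) ∖ₑ e′)) (filterᵇ (touches u) L)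
    drop-touching = ΣL-cong-All
      (λ e′ ue′ → cong Z (sym (filterᵇ-reject (disjointᵇ e′) L (touches⇒¬disjoint u e′ e ue′ ue))))
      (filterᵇ (touches u) L) (all-filterᵇ (touches u) L)

  vertexRecurrence-avoiding : (e : Edge m) (L : List (Edge m)) → VertexRecurrence L → VertexRecurrence (L ∖ₑ e) →
    Z (e ∷ L) ≡ Z (e ∷ filterᵇ (avoids u) L) - ΣL (λ e′ → Z ((e ∷ L) ∖ₑ e′)) (filterᵇ (touches u) L)
  vertexRecurrence-avoiding e L rec rec∖e = begin
    Z (e ∷ L)                                  ≡⟨ signedMatchings-∷ e L ⟩
    Z L - Z (L ∖ₑ e)                           ≡⟨ cong₂ _-_ rec rec∖e ⟩
    (Z Lᵤ - Σ-touching L) - (Z (filterᵇ (avoids u) (L ∖ₑ e)) - Σ-touching (L ∖ₑ e))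
      ≡⟨ cong₂ (λ x y → (Z Lᵤ - Σ-touching L) - (Z x - y)) (filterᵇ-comm (avoids u) (disjointᵇ e) L) Σ-touching-L∖e ⟩
    (Z Lᵤ - Σ-touching L) - (Z (Lᵤ ∖ₑ e) - ΣL g Tᵤ)
      ≡⟨ regroup (Z Lᵤ) (Σ-touching L) (Z (Lᵤ ∖ₑ e)) (ΣL g Tᵤ) ⟩
    (Z Lᵤ - Z (Lᵤ ∖ₑ e)) - (Σ-touching L - ΣL g Tᵤ)
      ≡⟨ cong₂ _-_ (sym (signedMatchings-∷ e Lᵤ))
                   (sym (trans (ΣL-cong add-e Tᵤ) (ΣL-- (λ e′ → Z (L ∖ₑ e′)) g Tᵤ))) ⟩
    Z (e ∷ Lᵤ) - ΣL (λ e′ → Z ((e ∷ L) ∖ₑ e′)) Tᵤ ∎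
    where
    open ≡-Reasoning
    Lᵤ = filterᵇ (avoids u) L
    Tᵤ = filterᵇ (touches u) L
    g : Edge m → ℤ
    g e′ = if disjointᵇ e′ e then Z ((L ∖ₑ e′) ∖ₑ e) else + 0
    regroup : ∀ a s x t → (a - s) - (x - t) ≡ (a - x) - (s - t)
    regroup = solve-∀
    Σ-touching-L∖e : Σ-touching (L ∖ₑ e) ≡ ΣL g Tᵤ
    Σ-touching-L∖e = begin
      ΣL (λ e′ → Z ((L ∖ₑ e) ∖ₑ e′)) (filterᵇ (touches u) (L ∖ₑ e))
        ≡⟨ cong (ΣL (λ e′ → Z ((L ∖ₑ e) ∖ₑ e′))) (filterᵇ-comm (touches u) (disjointᵇ e) L) ⟩
      ΣL (λ e′ → Z ((L ∖ₑ e) ∖ₑ e′)) (Tᵤ ∖ₑ e)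
        ≡⟨ ΣL-filterᵇ (disjointᵇ e) (λ e′ → Z ((L ∖ₑ e) ∖ₑ e′)) Tᵤ ⟩
      ΣL (λ e′ → if disjointᵇ e e′ then Z ((L ∖ₑ e) ∖ₑ e′) else + 0) Tᵤ
        ≡⟨ ΣL-cong swap Tᵤ ⟩
      ΣL g Tᵤ ∎
      where
      swap : ∀ e′ → (if disjointᵇ e e′ then Z ((L ∖ₑ e) ∖ₑ e′) else + 0) ≡ g e′
      swap e′ rewrite disjointᵇ-sym e e′ | filterᵇ-comm (disjointᵇ e′) (disjointᵇ e) L = refl
    add-e : ∀ e′ → Z ((e ∷ L) ∖ₑ e′) ≡ Z (L ∖ₑ e′) - g e′
    add-e e′ with disjointᵇ e′ e
    ... | true  = signedMatchings-∷ e (L ∖ₑ e′)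
    ... | false = sym (ℤP.+-identityʳ _)

  -- A matching meets u in at most one edge e, and removing e leaves a matching of the edges disjoint from e.
  signedMatchings-vertex : (L : List (Edge m)) → VertexRecurrence L
  signedMatchings-vertex L = go (length L) L ℕP.≤-refl
    where
    go : ∀ k L → length L ≤ k → VertexRecurrence L
    go _       []      _ = refl
    go (suc k) (e ∷ L) (s≤s |L|≤k) with touches u e in ue
    ... | true  = vertexRecurrence-touching e L ue (go k L |L|≤k)
    ... | false = vertexRecurrence-avoiding e L (go k L |L|≤k)
                    (go k (L ∖ₑ e) (ℕP.≤-trans (ListP.length-filter (T? ∘ disjointᵇ e) L) |L|≤k))

VertexSet : ℕ → Set
VertexSet m = Fin m → Bool

full : VertexSet m
full _ = true

infixl 6 _∖_
_∖_ : VertexSet m → Fin m → VertexSet m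
(S ∖ u) v = not (v == u) ∧ S v

edgesIn : Graph m → VertexSet m → List (Edge m)
edgesIn G S = filterᵇ (λ e → S (proj₁ e) ∧ S (proj₂ e)) (edges G)

-- μ(G[S], 1)
μ₁ : Graph m → VertexSet m → ℤ
μ₁ G S = signedMatchings (edgesIn G S)

μ₁-cong : (G : Graph m) {S S′ : VertexSet m} → (∀ v → S v ≡ S′ v) → μ₁ G S ≡ μ₁ G S′
μ₁-cong G S≗S′ =
  cong signedMatchings (filterᵇ-cong (λ e → cong₂ _∧_ (S≗S′ (proj₁ e)) (S≗S′ (proj₂ e))) (edges G))

edgesIn-avoids : (G : Graph m) (S : VertexSet m) (u : Fin m) →
                 filterᵇ (avoids u) (edgesIn G S) ≡ edgesIn G (S ∖ u)
edgesIn-avoids G S u = trans (filterᵇ-filterᵇ (avoids u) _ (edges G)) (filterᵇ-cong inS∖u (edges G))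
  where
  inS∖u : ∀ e → (S (proj₁ e) ∧ S (proj₂ e)) ∧ avoids u e ≡ (S ∖ u) (proj₁ e) ∧ (S ∖ u) (proj₂ e)
  inS∖u (i , j) =
    trans (cong ((S i ∧ S j) ∧_) (deMorgan₂ (i == u) (j == u)))
          (solve 4 (λ a b x y → (a ⊕ b) ⊕ (x ⊕ y) ⊜ (x ⊕ a) ⊕ (y ⊕ b)) refl (S i) (S j) (not (i == u)) (not (j == u)))
    where open ∧-Solver

edgesIn-disjoint : (G : Graph m) (S : VertexSet m) (a b : Fin m) →
                   filterᵇ (disjointᵇ (a , b)) (edgesIn G S) ≡ edgesIn G (S ∖ a ∖ b)
edgesIn-disjoint G S a b = trans (filterᵇ-filterᵇ (disjointᵇ (a , b)) _ (edges G)) (filterᵇ-cong inS∖a∖b (edges G))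
  where
  inS∖a∖b : ∀ e → (S (proj₁ e) ∧ S (proj₂ e)) ∧ disjointᵇ (a , b) e
                  ≡ (S ∖ a ∖ b) (proj₁ e) ∧ (S ∖ a ∖ b) (proj₂ e)
  inS∖a∖b (i , j) =
    trans (cong ((S i ∧ S j) ∧_) (trans (disjointᵇ-avoids a b (i , j))
                                      (cong₂ _∧_ (deMorgan₂ (i == a) (j == a)) (deMorgan₂ (i == b) (j == b)))))
          (solve 6 (λ s s′ x x′ y y′ → (s ⊕ s′) ⊕ ((x ⊕ x′) ⊕ (y ⊕ y′))
                                     ⊜ (y ⊕ (x ⊕ s)) ⊕ (y′ ⊕ (x′ ⊕ s′))) refl
                 (S i) (S j) (not (i == a)) (not (j == a)) (not (i == b)) (not (j == b)))
    where open ∧-Solver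

infix 4 _≺_
_≺_ : Edge m → Edge m → Set
(a , b) ≺ (c , d) = toℕ a < toℕ c ⊎ (toℕ a ≡ toℕ c × toℕ b < toℕ d)

≺-irrefl : (e : Edge m) → ¬ (e ≺ e)
≺-irrefl (a , b) (inj₁ a<a)       = ℕP.<-irrefl refl a<a
≺-irrefl (a , b) (inj₂ (_ , b<b)) = ℕP.<-irrefl refl b<b

≺-asym : (e e′ : Edge m) → e ≺ e′ → ¬ (e′ ≺ e)
≺-asym (a , b) (c , d) (inj₁ a<c)       (inj₁ c<a)       = ℕP.<-asym a<c c<a
≺-asym (a , b) (c , d) (inj₁ a<c)       (inj₂ (c≡a , _)) = ℕP.<-irrefl (sym c≡a) a<c
≺-asym (a , b) (c , d) (inj₂ (a≡c , _)) (inj₁ c<a)       = ℕP.<-irrefl (sym a≡c) c<a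
≺-asym (a , b) (c , d) (inj₂ (_ , b<d)) (inj₂ (_ , d<b)) = ℕP.<-asym b<d d<b

sorted-≡ : (xs ys : List (Edge m)) → AllPairs _≺_ xs → AllPairs _≺_ ys →
           (∀ z → z ∈ xs → z ∈ ys) → (∀ z → z ∈ ys → z ∈ xs) → xs ≡ ys
sorted-≡ []       []       _ _ _     _     = refl
sorted-≡ []       (y ∷ ys) _ _ _     ys⊆xs with () ← ys⊆xs y (here refl)
sorted-≡ (x ∷ xs) []       _ _ xs⊆ys _     with () ← xs⊆ys x (here refl)
sorted-≡ (x ∷ xs) (y ∷ ys) (x≺xs ∷ sxs) (y≺ys ∷ sys) xs⊆ys ys⊆xs with heads
  where
  heads : x ≡ y
  heads with xs⊆ys x (here refl) | ys⊆xs y (here refl)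
  ... | here x≡y   | _          = x≡y
  ... | there _    | here y≡x   = sym y≡x
  ... | there x∈ys | there y∈xs = ⊥-elim (≺-asym y x (All.lookup y≺ys x∈ys) (All.lookup x≺xs y∈xs))
... | refl = cong (x ∷_) (sorted-≡ xs ys sxs sys (λ z z∈xs → tail x≺xs z∈xs (xs⊆ys z (there z∈xs)))
                                                  (λ z z∈ys → tail y≺ys z∈ys (ys⊆xs z (there z∈ys))))
  where
  tail : ∀ {z} {us vs : List (Edge _)} → All (x ≺_) us → z ∈ us → z ∈ x ∷ vs → z ∈ vs
  tail x≺us z∈us (here refl) = ⊥-elim (≺-irrefl x (All.lookup x≺us z∈us))
  tail x≺us z∈us (there z∈vs) = z∈vs

allFin-sorted : ∀ m → AllPairs (λ i j → toℕ i < toℕ j) (allFin m)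
allFin-sorted m = AllPairsP.tabulate⁺-< (λ i<j → i<j)

allPairs-sorted : ∀ m → AllPairs _≺_ (allPairs m)
allPairs-sorted m =
  AllPairsP.concat⁺ (AllP.map⁺ (All.universal row-sorted (allFin m)))
                    (AllPairsP.map⁺ (AllPairsP.tabulate⁺-< rows-ordered))
  where
  row-sorted : ∀ i → AllPairs _≺_ (map (i ,_) (allFin m))
  row-sorted i = AllPairsP.map⁺ (AllPairsP.tabulate⁺-< (λ j<j′ → inj₂ (refl , j<j′)))
  rows-ordered : ∀ {i i′} → toℕ i < toℕ i′ →
                 All (λ e → All (e ≺_) (map (i′ ,_) (allFin m))) (map (i ,_) (allFin m))
  rows-ordered i<i′ = AllP.map⁺ (All.universal (λ _ → AllP.map⁺ (All.universal (λ _ → inj₁ i<i′) (allFin m))) (allFin m))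

edgesIn-sorted : (G : Graph m) (S : VertexSet m) → AllPairs _≺_ (edgesIn G S)
edgesIn-sorted {m} G S = AllPairsP.filter⁺ _ (AllPairsP.filter⁺ _ (allPairs-sorted m))

∈-edgesIn⁺ : (G : Graph m) (S : VertexSet m) {i j : Fin m} → toℕ i < toℕ j → adj G i j ≡ true →
             S i ≡ true → S j ≡ true → (i , j) ∈ edgesIn G S
∈-edgesIn⁺ G S {i} {j} i<j i~j Si Sj =
  ∈-filterᵇ⁺ _ (∈-filterᵇ⁺ _ ij∈allPairs i<ᵇj∧i~j) (cong₂ _∧_ Si Sj)
  where
  ij∈allPairs : (i , j) ∈ allPairs _
  ij∈allPairs = ∈P.∈-concat⁺′ (∈P.∈-map⁺ (i ,_) (∈P.∈-allFin j))
                              (∈P.∈-map⁺ (λ i → map (i ,_) (allFin _)) (∈P.∈-allFin i))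
  i<ᵇj∧i~j : ((toℕ i <ᵇ toℕ j) ∧ adj G i j) ≡ true
  i<ᵇj∧i~j rewrite i~j = trans (BP.∧-identityʳ _) (<⇒<ᵇ-true i<j)

∈-edgesIn⁻ : (G : Graph m) (S : VertexSet m) {i j : Fin m} → (i , j) ∈ edgesIn G S →
             toℕ i < toℕ j × adj G i j ≡ true × S i ≡ true × S j ≡ true
∈-edgesIn⁻ G S {i} {j} ij∈
  with ij∈edges , Si∧Sj ← ∈-filterᵇ⁻ (λ e → S (proj₁ e) ∧ S (proj₂ e)) {xs = edges G} ij∈
  with _ , i<ᵇj∧i~j ← ∈-filterᵇ⁻ _ {xs = allPairs _} ij∈edges
  with i<ᵇj , i~j ← ∧-true i<ᵇj∧i~j
  with Si , Sj ← ∧-true Si∧Sj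
  = <ᵇ-true⇒< i<ᵇj , i~j , Si , Sj

∖-comm : (S : VertexSet m) (a b v : Fin m) → (S ∖ a ∖ b) v ≡ (S ∖ b ∖ a) v
∖-comm S a b v = solve 3 (λ x y z → x ⊕ (y ⊕ z) ⊜ y ⊕ (x ⊕ z)) refl (not (v == b)) (not (v == a)) (S v)
  where open ∧-Solver

lowerNeighbour upperNeighbour : Graph m → VertexSet m → Fin m → Fin m → Bool
lowerNeighbour G S u v = (toℕ v <ᵇ toℕ u) ∧ (S v ∧ adj G v u)
upperNeighbour G S u v = (toℕ u <ᵇ toℕ v) ∧ (S v ∧ adj G u v)

edgesAt : Graph m → VertexSet m → Fin m → List (Edge m)
edgesAt {m} G S u = map (λ v → v , u) (filterᵇ (lowerNeighbour G S u) (allFin m))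
                 ++ map (λ v → u , v) (filterᵇ (upperNeighbour G S u) (allFin m))

edgesAt-sorted : (G : Graph m) (S : VertexSet m) (u : Fin m) → AllPairs _≺_ (edgesAt G S u)
edgesAt-sorted {m} G S u =
  AllPairsP.++⁺ (AllPairsP.map⁺ (AllPairs.map inj₁ (AllPairsP.filter⁺ _ (allFin-sorted m))))
                (AllPairsP.map⁺ (AllPairs.map (λ v<v′ → inj₂ (refl , v<v′)) (AllPairsP.filter⁺ _ (allFin-sorted m))))
                (AllP.map⁺ (All.map lower≺upper (all-filterᵇ (lowerNeighbour G S u) (allFin m))))
  where
  lower≺upper : ∀ {v} → lowerNeighbour G S u v ≡ true →
                All ((v , u) ≺_) (map (λ v′ → u , v′) (filterᵇ (upperNeighbour G S u) (allFin m)))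
  lower≺upper lower = AllP.map⁺ (All.universal (λ _ → inj₁ (<ᵇ-true⇒< (proj₁ (∧-true lower)))) _)

filterᵇ-touches-edgesIn : (G : Graph m) (S : VertexSet m) (u : Fin m) → S u ≡ true →
                          filterᵇ (touches u) (edgesIn G S) ≡ edgesAt G S u
filterᵇ-touches-edgesIn {m} G S u Su =
  sorted-≡ _ _ (AllPairsP.filter⁺ _ (edgesIn-sorted G S)) (edgesAt-sorted G S u) ⊆edgesAt edgesAt⊆
  where
  lowers = filterᵇ (lowerNeighbour G S u) (allFin m)
  ⊆edgesAt : ∀ e → e ∈ filterᵇ (touches u) (edgesIn G S) → e ∈ edgesAt G S u
  ⊆edgesAt (i , j) e∈ with e∈edgesIn , touch ← ∈-filterᵇ⁻ (touches u) e∈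
    with i<j , i~j , Si , Sj ← ∈-edgesIn⁻ G S e∈edgesIn | i == u in i==u
  ... | true  with refl ← ==⇒≡ {i = i} {u} i==u =
    ∈P.∈-++⁺ʳ (map (λ v → v , u) lowers)
      (∈P.∈-map⁺ (u ,_) (∈-filterᵇ⁺ (upperNeighbour G S u) (∈P.∈-allFin j)
                           (cong₂ _∧_ (<⇒<ᵇ-true i<j) (cong₂ _∧_ Sj i~j))))
  ... | false with refl ← ==⇒≡ {i = j} {u} touch =
    ∈P.∈-++⁺ˡ (∈P.∈-map⁺ (λ v → v , u) (∈-filterᵇ⁺ (lowerNeighbour G S u) (∈P.∈-allFin i)
                                          (cong₂ _∧_ (<⇒<ᵇ-true i<j) (cong₂ _∧_ Si i~j))))
  edgesAt⊆ : ∀ e → e ∈ edgesAt G S u → e ∈ filterᵇ (touches u) (edgesIn G S)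
  edgesAt⊆ e e∈ with ∈P.∈-++⁻ (map (λ v → v , u) lowers) e∈
  ... | inj₁ e∈lower
    with v , v∈ , refl ← ∈P.∈-map⁻ (λ v → v , u) e∈lower
    with v<ᵇu , Sv∧v~u ← ∧-true (proj₂ (∈-filterᵇ⁻ (lowerNeighbour G S u) {xs = allFin m} v∈))
    with Sv , v~u ← ∧-true Sv∧v~u
    = ∈-filterᵇ⁺ (touches u) (∈-edgesIn⁺ G S (<ᵇ-true⇒< v<ᵇu) v~u Sv Su)
                 (trans (cong (v == u ∨_) (==-refl u)) (BP.∨-zeroʳ _))
  ... | inj₂ e∈upper
    with v , v∈ , refl ← ∈P.∈-map⁻ (λ v → u , v) e∈upper
    with u<ᵇv , Sv∧u~v ← ∧-true (proj₂ (∈-filterᵇ⁻ (upperNeighbour G S u) {xs = allFin m} v∈))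
    with Sv , u~v ← ∧-true Sv∧u~v
    = ∈-filterᵇ⁺ (touches u) (∈-edgesIn⁺ G S (<ᵇ-true⇒< u<ᵇv) u~v Su Sv)
                 (cong (_∨ v == u) (==-refl u))

ΣL-edgesAt : (G : Graph m) (S : VertexSet m) (u : Fin m) →
  ΣL (λ e → μ₁ G (S ∖ proj₁ e ∖ proj₂ e)) (edgesAt G S u)
    ≡ ΣF m (λ v → if S v ∧ adj G u v then μ₁ G (S ∖ u ∖ v) else + 0)
ΣL-edgesAt {m} G S u =
  trans (ΣL-++ μ₁∖ (map (λ v → v , u) lowers) (map (λ v → u , v) uppers))
        (trans (cong₂ _+_ Σ-lowers Σ-uppers) (trans (sym (ΣF-+ m _ _)) (ΣF-cong m merge)))
  where
  μ₁∖ : Edge m → ℤ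
  μ₁∖ e = μ₁ G (S ∖ proj₁ e ∖ proj₂ e)
  lowers = filterᵇ (lowerNeighbour G S u) (allFin m)
  uppers = filterᵇ (upperNeighbour G S u) (allFin m)
  Σ-lowers : ΣL μ₁∖ (map (λ v → v , u) lowers)
             ≡ ΣF m (λ v → if lowerNeighbour G S u v then μ₁∖ (v , u) else + 0)
  Σ-lowers = trans (ΣL-map μ₁∖ (λ v → v , u) lowers)
                   (trans (ΣL-filterᵇ (lowerNeighbour G S u) _ (allFin m)) (ΣF-tabulate m _ (λ v → v)))
  Σ-uppers : ΣL μ₁∖ (map (λ v → u , v) uppers)
             ≡ ΣF m (λ v → if upperNeighbour G S u v then μ₁∖ (u , v) else + 0)
  Σ-uppers = trans (ΣL-map μ₁∖ (λ v → u , v) uppers)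
                   (trans (ΣL-filterᵇ (upperNeighbour G S u) _ (allFin m)) (ΣF-tabulate m _ (λ v → v)))
  merge : ∀ v → (if lowerNeighbour G S u v then μ₁∖ (v , u) else + 0)
                + (if upperNeighbour G S u v then μ₁∖ (u , v) else + 0)
              ≡ (if S v ∧ adj G u v then μ₁ G (S ∖ u ∖ v) else + 0)
  merge v rewrite μ₁-cong G (∖-comm S v u) | Graph.sym G v u
    with toℕ v <ᵇ toℕ u in v<u | toℕ u <ᵇ toℕ v in u<v
  ... | true  | true  = ⊥-elim (ℕP.<-asym (<ᵇ-true⇒< {toℕ v} v<u) (<ᵇ-true⇒< {toℕ u} u<v))
  ... | true  | false = ℤP.+-identityʳ _
  ... | false | true  = ℤP.+-identityˡ _
  ... | false | false with refl ← FinP.toℕ-injective {i = v} {u} (ℕP.≤-antisym (<ᵇ-false⇒≥ u<v) (<ᵇ-false⇒≥ v<u))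
    rewrite Graph.irrefl G v | BP.∧-zeroʳ (S v) = refl

μ₁-vertex : (G : Graph m) (S : VertexSet m) (u : Fin m) → S u ≡ true →
  μ₁ G S ≡ μ₁ G (S ∖ u) - ΣF m (λ v → if S v ∧ adj G u v then μ₁ G (S ∖ u ∖ v) else + 0)
μ₁-vertex {m} G S u Su = begin
  μ₁ G S
    ≡⟨ signedMatchings-vertex u (edgesIn G S) ⟩
  signedMatchings (filterᵇ (avoids u) (edgesIn G S))
    - ΣL (λ e → signedMatchings (filterᵇ (disjointᵇ e) (edgesIn G S))) (filterᵇ (touches u) (edgesIn G S))
    ≡⟨ cong₂ _-_ (cong signedMatchings (edgesIn-avoids G S u))
                 (ΣL-cong (λ e → cong signedMatchings (edgesIn-disjoint G S (proj₁ e) (proj₂ e)))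
                          (filterᵇ (touches u) (edgesIn G S))) ⟩
  μ₁ G (S ∖ u) - ΣL μ₁∖ (filterᵇ (touches u) (edgesIn G S))
    ≡⟨ cong (λ es → μ₁ G (S ∖ u) - ΣL μ₁∖ es) (filterᵇ-touches-edgesIn G S u Su) ⟩
  μ₁ G (S ∖ u) - ΣL μ₁∖ (edgesAt G S u)
    ≡⟨ cong (λ x → μ₁ G (S ∖ u) - x) (ΣL-edgesAt G S u) ⟩
  μ₁ G (S ∖ u) - ΣF m (λ v → if S v ∧ adj G u v then μ₁ G (S ∖ u ∖ v) else + 0) ∎
  where
  open ≡-Reasoning
  μ₁∖ : Edge m → ℤ
  μ₁∖ e = μ₁ G (S ∖ proj₁ e ∖ proj₂ e)

Monotone : (Fin n → Fin m) → Set
Monotone f = ∀ i j → toℕ i < toℕ j → toℕ (f i) < toℕ (f j)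

monotone-reflects-< : (f : Fin n → Fin m) → Monotone f → ∀ i j → toℕ (f i) < toℕ (f j) → toℕ i < toℕ j
monotone-reflects-< f mono i j fi<fj with ℕP.<-cmp (toℕ i) (toℕ j)
... | tri< i<j _ _ = i<j
... | tri≈ _ i≡j _ rewrite FinP.toℕ-injective i≡j = ⊥-elim (ℕP.<-irrefl refl fi<fj)
... | tri> _ _ j<i = ⊥-elim (ℕP.<-asym fi<fj (mono j i j<i))

monotone-injective : (f : Fin n → Fin m) → Monotone f → ∀ i j → f i ≡ f j → i ≡ j
monotone-injective f mono i j fi≡fj with ℕP.<-cmp (toℕ i) (toℕ j)
... | tri< i<j _ _ = ⊥-elim (ℕP.<-irrefl (cong toℕ fi≡fj) (mono i j i<j))
... | tri≈ _ i≡j _ = FinP.toℕ-injective i≡j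
... | tri> _ _ j<i = ⊥-elim (ℕP.<-irrefl (cong toℕ (sym fi≡fj)) (mono j i j<i))

mapEdge : (Fin n → Fin m) → Edge n → Edge m
mapEdge f (i , j) = f i , f j

module _ (f : Fin n → Fin m) (mono : Monotone f) where

  ==-map : ∀ a c → (f a == f c) ≡ (a == c)
  ==-map a c with a == c in a==c
  ... | true  rewrite ==⇒≡ {i = a} {c} a==c = ==-refl (f c)
  ... | false = ≢⇒==-false (λ fa≡fc → ==-false⇒≢ a==c (monotone-injective f mono a c fa≡fc))

  disjointᵇ-map : ∀ e e′ → disjointᵇ (mapEdge f e) (mapEdge f e′) ≡ disjointᵇ e e′
  disjointᵇ-map (a , b) (c , d)
    rewrite isYes-≟ (f a) (f c) | isYes-≟ (f a) (f d) | isYes-≟ (f b) (f c) | isYes-≟ (f b) (f d)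
          | isYes-≟ a c | isYes-≟ a d | isYes-≟ b c | isYes-≟ b d
          | ==-map a c | ==-map a d | ==-map b c | ==-map b d = refl

  isMatchingᵇ-map : ∀ M → isMatchingᵇ (map (mapEdge f) M) ≡ isMatchingᵇ M
  isMatchingᵇ-map []      = refl
  isMatchingᵇ-map (e ∷ M) = cong₂ _∧_ (allᵇ-disjoint e M) (isMatchingᵇ-map M)
    where
    allᵇ-disjoint : ∀ e M → allᵇ (disjointᵇ (mapEdge f e)) (map (mapEdge f) M) ≡ allᵇ (disjointᵇ e) M
    allᵇ-disjoint e []       = refl
    allᵇ-disjoint e (e′ ∷ M) = cong₂ _∧_ (disjointᵇ-map e e′) (allᵇ-disjoint e M)

  signedMatchings-map : ∀ L → signedMatchings (map (mapEdge f) L) ≡ signedMatchings L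
  signedMatchings-map L rewrite sublists-map (mapEdge f) L =
    trans (ΣL-map matchingSign (map (mapEdge f)) (sublists L)) (ΣL-cong sign-map (sublists L))
    where
    sign-map : ∀ M → matchingSign (map (mapEdge f) M) ≡ matchingSign M
    sign-map M rewrite isMatchingᵇ-map M | ListP.length-map (mapEdge f) M = refl

  module _ (H : Graph n) (G : Graph m) (adj-map : ∀ i j → adj G (f i) (f j) ≡ adj H i j)
           (S : VertexSet n) (S′ : VertexSet m) (S′-map : ∀ i → S′ (f i) ≡ S i)
           (S′⊆image : ∀ v → S′ v ≡ true → Σ (Fin n) (λ i → f i ≡ v)) where

    edgesIn-map : edgesIn G S′ ≡ map (mapEdge f) (edgesIn H S)
    edgesIn-map = sorted-≡ _ _ (edgesIn-sorted G S′)
                               (AllPairsP.map⁺ (AllPairs.map map-≺ (edgesIn-sorted H S))) ⊆map map⊆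
      where
      map-≺ : ∀ {e e′} → e ≺ e′ → mapEdge f e ≺ mapEdge f e′
      map-≺ {i , j} {i′ , j′} (inj₁ i<i′) = inj₁ (mono i i′ i<i′)
      map-≺ {i , j} {i′ , j′} (inj₂ (i≡i′ , j<j′)) rewrite FinP.toℕ-injective {i = i} {i′} i≡i′ =
        inj₂ (refl , mono j j′ j<j′)
      ⊆map : ∀ e → e ∈ edgesIn G S′ → e ∈ map (mapEdge f) (edgesIn H S)
      ⊆map (v , w) e∈ with v<w , v~w , S′v , S′w ← ∈-edgesIn⁻ G S′ e∈
        with i , refl ← S′⊆image v S′v | j , refl ← S′⊆image w S′w =
        ∈P.∈-map⁺ (mapEdge f) (∈-edgesIn⁺ H S (monotone-reflects-< f mono i j v<w)
                                 (trans (sym (adj-map i j)) v~w) (trans (sym (S′-map i)) S′v) (trans (sym (S′-map j)) S′w))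
      map⊆ : ∀ e → e ∈ map (mapEdge f) (edgesIn H S) → e ∈ edgesIn G S′
      map⊆ e e∈ with (i , j) , ij∈ , refl ← ∈P.∈-map⁻ (mapEdge f) e∈
        with i<j , i~j , Si , Sj ← ∈-edgesIn⁻ H S ij∈ =
        ∈-edgesIn⁺ G S′ (mono i j i<j) (trans (adj-map i j) i~j) (trans (S′-map i) Si) (trans (S′-map j) Sj)

    μ₁-map : μ₁ G S′ ≡ μ₁ H S
    μ₁-map = trans (cong signedMatchings edgesIn-map) (signedMatchings-map (edgesIn H S))

edgesIn-full : (G : Graph m) → edgesIn G full ≡ edges G
edgesIn-full G = ListP.filter-all (T? ∘ _) (All.universal _ (edges G))

eval1-μ≡μ₁ : (G : Graph m) → eval1 (μ G) ≡ μ₁ G full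
eval1-μ≡μ₁ G = trans (eval1-μ≡signedMatchings G) (cong signedMatchings (sym (edgesIn-full G)))

punchIn-monotone : (u : Fin (suc n)) → Monotone (punchIn u)
punchIn-monotone u i j i<j =
  ℕP.≤∧≢⇒< (FinP.punchIn-mono-≤ u i j (ℕP.<⇒≤ i<j))
           (λ eq → ℕP.<-irrefl (cong toℕ (FinP.punchIn-injective u i j (FinP.toℕ-injective eq))) i<j)

eval1-μ-delete : (G : Graph (suc n)) (u : Fin (suc n)) → eval1 (μ (delete G u)) ≡ μ₁ G (full ∖ u)
eval1-μ-delete G u =
  trans (eval1-μ≡μ₁ (delete G u))
        (sym (μ₁-map (punchIn u) (punchIn-monotone u) (delete G u) G (λ _ _ → refl) full (full ∖ u) kept image))
  where
  kept : ∀ i → (full ∖ u) (punchIn u i) ≡ true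
  kept i = cong (λ b → not b ∧ true) (≢⇒==-false (FinP.punchInᵢ≢i u i))
  image : ∀ v → (full ∖ u) v ≡ true → Σ (Fin _) (λ i → punchIn u i ≡ v)
  image v v≠u with v == u in v==u
  ... | false = punchOut u≢v , FinP.punchIn-punchOut u≢v
    where
    u≢v : u ≢ v
    u≢v u≡v = ==-false⇒≢ v==u (sym u≡v)

-- Godsil's identity μ′(G, x) = Σ_u μ(G ∖ u, x) at x = 1.
deriv1-μ≡Σμ₁ : (G : Graph m) → deriv1 (μ G) ≡ ΣF m (λ u → μ₁ G (full ∖ u))
deriv1-μ≡Σμ₁ {m} G = begin
  deriv1 (μ G)                                        ≡⟨ deriv1-μ≡ΣuncoveredSign G ⟩
  ΣL (uncoveredSign m) (sublists (edges G))           ≡⟨ ΣF-signedMatchings-avoiding (edges G) (edges-NonLoop G) ⟨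
  ΣF m (λ u → signedMatchings (filterᵇ (avoids u) (edges G))) ≡⟨ ΣF-cong m (cong signedMatchings ∘ avoiding) ⟩
  ΣF m (λ u → μ₁ G (full ∖ u))                        ∎
  where
  open ≡-Reasoning
  avoiding : ∀ u → filterᵇ (avoids u) (edges G) ≡ edgesIn G (full ∖ u)
  avoiding u = trans (cong (filterᵇ (avoids u)) (sym (edgesIn-full G))) (edgesIn-avoids G full u)

-- All μ(G ∖ u, 1) having the sign of s makes μ′(G, 1) ≠ 0, so m(1, G) = 1 and every m(1, G ∖ u) = 0.
oneCritical-criterion : (G : Graph (suc n)) (s : ℤ) → μ₁ G full ≡ + 0 →
                        (∀ u → + 0 ℤ.< s * μ₁ G (full ∖ u)) → OneCritical G
oneCritical-criterion {n} G s μ[G]≡0 sgn-μ[G∖u] =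
  1 , s≤s z≤n ,
  (eval1≡0⇒[x-1]∣ (μ G) (trans (eval1-μ≡μ₁ G) μ[G]≡0) , deriv1≢0⇒[x-1]²∤ (μ G) μ′[G]≢0) ,
  λ u → [x-1]⁰∣ (μ (delete G u)) , eval1≢0⇒[x-1]∤ (μ (delete G u)) (μ[G∖u]≢0 u)
  where
  nonzero : ∀ x → + 0 ℤ.< s * x → x ≢ + 0
  nonzero x 0<sx refl = ℤP.<-irrefl (sym (ℤP.*-zeroʳ s)) 0<sx
  μ[G∖u]≢0 : ∀ u → eval1 (μ (delete G u)) ≢ + 0
  μ[G∖u]≢0 u = nonzero _ (subst (λ x → + 0 ℤ.< s * x) (sym (eval1-μ-delete G u)) (sgn-μ[G∖u] u))
  μ′[G]≢0 : deriv1 (μ G) ≢ + 0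
  μ′[G]≢0 = nonzero _ (subst (+ 0 ℤ.<_)
                             (trans (ΣF-scale (suc n) s (λ u → μ₁ G (full ∖ u))) (cong (s *_) (sym (deriv1-μ≡Σμ₁ G))))
                             (ΣF-pos n (λ u → s * μ₁ G (full ∖ u)) sgn-μ[G∖u]))

-- Consequences of the recurrences satisfied by the subdivided graph G′: F bx by bz S plays μ(G′[S′], 1) for
-- S′ = S plus those of x, y, z selected by bx, by, bz, h S plays μ((G - ab)[S], 1) and Z S plays μ(G[S], 1).
-- Keeping them abstract stops the type checker from unfolding μ₁ in the rewrites below.
module SubdivisionAlgebra
  (a b : Fin n) (a≢b : (a == b) ≡ false)
  (F : Bool → Bool → Bool → VertexSet n → ℤ) (h Z : VertexSet n → ℤ)
  (h-cong : ∀ {S S′} → (∀ v → S v ≡ S′ v) → h S ≡ h S′)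
  (F-old : ∀ S → F false false false S ≡ h S)
  (F-x : ∀ bz S → F true false bz S ≡ F false false bz S - (if S a then F false false bz (S ∖ a) else + 0))
  (F-z : ∀ S → F false false true S ≡ F false false false S - (if S b then F false false false (S ∖ b) else + 0))
  (F-y : ∀ bx bz S → F bx true bz S ≡ F bx false bz S - ((if bx then F false false bz S else + 0)
                                                         + (if bz then F bx false false S else + 0)))
  (Z-ab : ∀ S → S a ≡ true → S b ≡ true → Z S ≡ h S - h (S ∖ a ∖ b))
  (Z-¬ab : ∀ S → (S a ∧ S b) ≡ false → Z S ≡ h S)
  where

  ∖a-b : ∀ S → (S ∖ a) b ≡ S b
  ∖a-b S rewrite ==-sym b a | a≢b = refl

  F-all : ∀ S → F true true true S ≡ - Z S
  F-all S
    rewrite F-y true true S | F-x true S | F-x false S | F-z S | F-z (S ∖ a) | ∖a-b S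
          | F-old S | F-old (S ∖ a) | F-old (S ∖ b) | F-old (S ∖ a ∖ b)
    with S a in Sa | S b in Sb
  ... | true  | true  rewrite Z-ab S Sa Sb = both (h S) (h (S ∖ a)) (h (S ∖ b)) (h (S ∖ a ∖ b))
    where
    both : ∀ x y z w → (x - z - (y - w)) - ((x - z) + (x - y)) ≡ - (x - w)
    both = solve-∀
  ... | true  | false rewrite Z-¬ab S (trans (cong (S a ∧_) Sb) (BP.∧-zeroʳ (S a))) = only-a (h S) (h (S ∖ a))
    where
    only-a : ∀ x y → (x - + 0 - (y - + 0)) - ((x - + 0) + (x - y)) ≡ - x
    only-a = solve-∀
  ... | false | true  rewrite Z-¬ab S (cong (_∧ S b) Sa) = only-b (h S) (h (S ∖ b))
    where
    only-b : ∀ x z → (x - z - + 0) - ((x - z) + (x - + 0)) ≡ - x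
    only-b = solve-∀
  ... | false | false rewrite Z-¬ab S (cong (_∧ S b) Sa) = neither (h S)
    where
    neither : ∀ x → (x - + 0 - + 0) - ((x - + 0) + (x - + 0)) ≡ - x
    neither = solve-∀

  Z-∖a : Z (full ∖ a) ≡ h (full ∖ a)
  Z-∖a = Z-¬ab (full ∖ a) (cong (λ t → (not t ∧ true) ∧ (full ∖ a) b) (==-refl a))

  Z-∖b : Z (full ∖ b) ≡ h (full ∖ b)
  Z-∖b = Z-¬ab (full ∖ b) (trans (cong (λ t → (full ∖ b) a ∧ (not t ∧ true)) (==-refl b)) (BP.∧-zeroʳ _))

  Z-∖a∖b : Z (full ∖ a ∖ b) ≡ h (full ∖ a ∖ b)
  Z-∖a∖b = Z-¬ab (full ∖ a ∖ b)
    (trans (cong (λ t → (not (a == b) ∧ (not t ∧ true)) ∧ (full ∖ a ∖ b) b) (==-refl a))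
           (cong (_∧ (full ∖ a ∖ b) b) (BP.∧-zeroʳ (not (a == b)))))

  cancelˡ : ∀ x y → x - y - (+ 0 + x) ≡ - y
  cancelˡ = solve-∀

  cancelʳ : ∀ x y → x - y - (x + + 0) ≡ - y
  cancelʳ = solve-∀

  F-∖x : F false true true full ≡ - Z (full ∖ b)
  F-∖x rewrite F-y false true full | F-z full | F-old full | F-old (full ∖ b) | Z-∖b =
    cancelˡ (h full) (h (full ∖ b))

  F-∖z : F true true false full ≡ - Z (full ∖ a)
  F-∖z rewrite F-y true false full | F-x false full | F-old full | F-old (full ∖ a) | Z-∖a =
    cancelʳ (h full) (h (full ∖ a))

  F-∖z∖b : F true true false (full ∖ b) ≡ - Z (full ∖ a ∖ b)
  F-∖z∖b rewrite F-y true false (full ∖ b) | F-x false (full ∖ b) | F-old (full ∖ b) | cong not a≢b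
               | F-old (full ∖ b ∖ a) | Z-∖a∖b | h-cong (∖-comm full b a) =
    cancelʳ (h (full ∖ b)) (h (full ∖ a ∖ b))

  F-∖y : F true false true full ≡ Z full - Z (full ∖ a) - Z (full ∖ b) + (Z (full ∖ a ∖ b) + Z (full ∖ a ∖ b))
  F-∖y rewrite F-x true full | F-z full | F-z (full ∖ a) | ∖a-b full
             | F-old full | F-old (full ∖ a) | F-old (full ∖ b) | F-old (full ∖ a ∖ b)
             | Z-ab full refl refl | Z-∖a | Z-∖b | Z-∖a∖b =
    expand (h full) (h (full ∖ a)) (h (full ∖ b)) (h (full ∖ a ∖ b))
    where
    expand : ∀ x y z w → (x - z) - (y - w) ≡ (x - w) - y - z + (w + w)
    expand = solve-∀

-- In the subdivided graph the new vertices x, y, z come first.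
pattern x₀    = zero
pattern y₀    = suc zero
pattern z₀    = suc (suc zero)
pattern old i = suc (suc (suc i))

module Subdivision (G : Graph n) (a b : Fin n) (a~b : adj G a b ≡ true) where

  a≢b : (a == b) ≡ false
  a≢b with a == b in a==b
  ... | false = refl
  ... | true with refl ← ==⇒≡ {i = a} {b} a==b with () ← trans (sym (Graph.irrefl G a)) a~b

  isAB : Fin n → Fin n → Bool
  isAB i j = (i == a ∧ j == b) ∨ (i == b ∧ j == a)

  isAB-sym : ∀ i j → isAB i j ≡ isAB j i
  isAB-sym i j = solve 4 (λ p q r s → (p :* q) :+ (r :* s) := (s :* r) :+ (q :* p)) refl
                         (i == a) (j == b) (i == b) (j == a)
    where open ∨-∧-Solver

  G∖ab : Graph n
  G∖ab = record
    { adj    = λ i j → adj G i j ∧ not (isAB i j)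
    ; sym    = λ i j → cong₂ _∧_ (Graph.sym G i j) (cong not (isAB-sym i j))
    ; irrefl = λ i → cong (_∧ not (isAB i i)) (Graph.irrefl G i)
    }

  adjG′ : Fin (3 ℕ.+ n) → Fin (3 ℕ.+ n) → Bool
  adjG′ x₀      x₀      = false
  adjG′ x₀      y₀      = true
  adjG′ x₀      z₀      = false
  adjG′ x₀      (old j) = j == a
  adjG′ y₀      x₀      = true
  adjG′ y₀      y₀      = false
  adjG′ y₀      z₀      = true
  adjG′ y₀      (old j) = false
  adjG′ z₀      x₀      = false
  adjG′ z₀      y₀      = true
  adjG′ z₀      z₀      = false
  adjG′ z₀      (old j) = j == b
  adjG′ (old i) x₀      = i == a
  adjG′ (old i) y₀      = false
  adjG′ (old i) z₀      = i == b
  adjG′ (old i) (old j) = adj G∖ab i j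

  adjG′-sym : ∀ i j → adjG′ i j ≡ adjG′ j i
  adjG′-sym x₀      x₀      = refl
  adjG′-sym x₀      y₀      = refl
  adjG′-sym x₀      z₀      = refl
  adjG′-sym x₀      (old j) = refl
  adjG′-sym y₀      x₀      = refl
  adjG′-sym y₀      y₀      = refl
  adjG′-sym y₀      z₀      = refl
  adjG′-sym y₀      (old j) = refl
  adjG′-sym z₀      x₀      = refl
  adjG′-sym z₀      y₀      = refl
  adjG′-sym z₀      z₀      = refl
  adjG′-sym z₀      (old j) = refl
  adjG′-sym (old i) x₀      = refl
  adjG′-sym (old i) y₀      = refl
  adjG′-sym (old i) z₀      = refl
  adjG′-sym (old i) (old j) = Graph.sym G∖ab i j

  adjG′-irrefl : ∀ i → adjG′ i i ≡ false
  adjG′-irrefl x₀      = refl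
  adjG′-irrefl y₀      = refl
  adjG′-irrefl z₀      = refl
  adjG′-irrefl (old i) = Graph.irrefl G∖ab i

  G′ : Graph (3 ℕ.+ n)
  G′ = record { adj = adjG′ ; sym = adjG′-sym ; irrefl = adjG′-irrefl }

  extend : Bool → Bool → Bool → VertexSet n → VertexSet (3 ℕ.+ n)
  extend bx by bz S x₀      = bx
  extend bx by bz S y₀      = by
  extend bx by bz S z₀      = bz
  extend bx by bz S (old i) = S i

  μ₁′ : Bool → Bool → Bool → VertexSet n → ℤ
  μ₁′ bx by bz S = μ₁ G′ (extend bx by bz S)

  μ₁-G′ : (S′ : VertexSet (3 ℕ.+ n)) → μ₁ G′ S′ ≡ μ₁′ (S′ x₀) (S′ y₀) (S′ z₀) (λ i → S′ (old i))
  μ₁-G′ S′ = μ₁-cong G′ {S′} {extend (S′ x₀) (S′ y₀) (S′ z₀) (λ i → S′ (old i))}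
                     λ { x₀ → refl ; y₀ → refl ; z₀ → refl ; (old i) → refl }

  ΣF-old : (f : Fin (3 ℕ.+ n) → ℤ) → f x₀ ≡ + 0 → f y₀ ≡ + 0 → f z₀ ≡ + 0 →
           ΣF (3 ℕ.+ n) f ≡ ΣF n (λ i → f (old i))
  ΣF-old f fx fy fz =
    trans (cong₂ _+_ fx (cong₂ _+_ fy (cong₂ _+_ fz refl)))
          (trans (ℤP.+-identityˡ _) (trans (ℤP.+-identityˡ _) (ℤP.+-identityˡ _)))

  μ₁′-old : ∀ S → μ₁′ false false false S ≡ μ₁ G∖ab S
  μ₁′-old S = μ₁-map (λ i → old i) (λ _ _ i<j → s≤s (s≤s (s≤s i<j))) G∖ab G′ (λ _ _ → refl)
                     S (extend false false false S) (λ _ → refl) image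
    where
    image : ∀ v → extend false false false S v ≡ true → Σ (Fin n) (λ i → old i ≡ v)
    image (old i) _ = i , refl

  recurrence-x : ∀ bz S → μ₁′ true false bz S
                          ≡ μ₁′ false false bz S - (if S a then μ₁′ false false bz (S ∖ a) else + 0)
  recurrence-x bz S = begin
    μ₁′ true false bz S
      ≡⟨ μ₁-vertex G′ S′ x₀ refl ⟩
    μ₁ G′ (S′ ∖ x₀) - ΣF (3 ℕ.+ n) f
      ≡⟨ cong₂ _-_ (μ₁-G′ (S′ ∖ x₀)) (trans (ΣF-old f refl refl fz) (ΣF-select S a _)) ⟩
    μ₁′ false false bz S - (if S a then μ₁ G′ (S′ ∖ x₀ ∖ old a) else + 0)
      ≡⟨ cong (λ t → μ₁′ false false bz S - (if S a then t else + 0)) (μ₁-G′ (S′ ∖ x₀ ∖ old a)) ⟩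
    μ₁′ false false bz S - (if S a then μ₁′ false false bz (S ∖ a) else + 0) ∎
    where
    open ≡-Reasoning
    S′ = extend true false bz S
    f : Fin (3 ℕ.+ n) → ℤ
    f v = if S′ v ∧ adjG′ x₀ v then μ₁ G′ (S′ ∖ x₀ ∖ v) else + 0
    fz : f z₀ ≡ + 0
    fz = cong (λ c → if c then μ₁ G′ (S′ ∖ x₀ ∖ z₀) else + 0) (BP.∧-zeroʳ bz)

  recurrence-z : ∀ S → μ₁′ false false true S
                       ≡ μ₁′ false false false S - (if S b then μ₁′ false false false (S ∖ b) else + 0)
  recurrence-z S = begin
    μ₁′ false false true S
      ≡⟨ μ₁-vertex G′ S′ z₀ refl ⟩
    μ₁ G′ (S′ ∖ z₀) - ΣF (3 ℕ.+ n) f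
      ≡⟨ cong₂ _-_ (μ₁-G′ (S′ ∖ z₀)) (trans (ΣF-old f refl refl refl) (ΣF-select S b _)) ⟩
    μ₁′ false false false S - (if S b then μ₁ G′ (S′ ∖ z₀ ∖ old b) else + 0)
      ≡⟨ cong (λ t → μ₁′ false false false S - (if S b then t else + 0)) (μ₁-G′ (S′ ∖ z₀ ∖ old b)) ⟩
    μ₁′ false false false S - (if S b then μ₁′ false false false (S ∖ b) else + 0) ∎
    where
    open ≡-Reasoning
    S′ = extend false false true S
    f : Fin (3 ℕ.+ n) → ℤ
    f v = if S′ v ∧ adjG′ z₀ v then μ₁ G′ (S′ ∖ z₀ ∖ v) else + 0

  recurrence-y : ∀ bx bz S →
    μ₁′ bx true bz S ≡ μ₁′ bx false bz S - ((if bx then μ₁′ false false bz S else + 0)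
                                            + (if bz then μ₁′ bx false false S else + 0))
  recurrence-y bx bz S = begin
    μ₁′ bx true bz S
      ≡⟨ μ₁-vertex G′ S′ y₀ refl ⟩
    μ₁ G′ (S′ ∖ y₀) - (f x₀ + (+ 0 + (f z₀ + ΣF n (λ i → f (old i)))))
      ≡⟨ cong₂ (λ s t → s - (f x₀ + (+ 0 + (f z₀ + t)))) (μ₁-G′ (S′ ∖ y₀)) no-old ⟩
    μ₁′ bx false bz S - (f x₀ + (+ 0 + (f z₀ + + 0)))
      ≡⟨ cong (_-_ (μ₁′ bx false bz S)) (drop-zeros (f x₀) (f z₀)) ⟩
    μ₁′ bx false bz S - (f x₀ + f z₀)
      ≡⟨ cong₂ (λ s t → μ₁′ bx false bz S - (s + t)) fx fz ⟩
    μ₁′ bx false bz S - ((if bx then μ₁′ false false bz S else + 0) + (if bz then μ₁′ bx false false S else + 0)) ∎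
    where
    open ≡-Reasoning
    S′ = extend bx true bz S
    f : Fin (3 ℕ.+ n) → ℤ
    f v = if S′ v ∧ adjG′ y₀ v then μ₁ G′ (S′ ∖ y₀ ∖ v) else + 0
    no-old : ΣF n (λ i → f (old i)) ≡ + 0
    no-old = trans (ΣF-cong n (λ i → cong (λ c → if c then μ₁ G′ (S′ ∖ y₀ ∖ old i) else + 0) (BP.∧-zeroʳ (S i))))
                   (ΣF-zero n)
    drop-zeros : ∀ p q → p + (+ 0 + (q + + 0)) ≡ p + q
    drop-zeros = solve-∀
    fx : f x₀ ≡ (if bx then μ₁′ false false bz S else + 0)
    fx = trans (cong (λ c → if c then μ₁ G′ (S′ ∖ y₀ ∖ x₀) else + 0) (BP.∧-identityʳ bx))
               (cong (λ t → if bx then t else + 0) (μ₁-G′ (S′ ∖ y₀ ∖ x₀)))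
    fz : f z₀ ≡ (if bz then μ₁′ bx false false S else + 0)
    fz = trans (cong (λ c → if c then μ₁ G′ (S′ ∖ y₀ ∖ z₀) else + 0) (BP.∧-identityʳ bz))
               (cong (λ t → if bz then t else + 0) (μ₁-G′ (S′ ∖ y₀ ∖ z₀)))

  μ₁-G∖ab : ∀ S → (S a ∧ S b) ≡ false → μ₁ G S ≡ μ₁ G∖ab S
  μ₁-G∖ab S ¬ab = cong signedMatchings (begin
    edgesIn G S                                            ≡⟨ filterᵇ-filterᵇ inS _ (allPairs n) ⟩
    filterᵇ (λ e → isEdge G e ∧ inS e) (allPairs n)       ≡⟨ filterᵇ-cong same-edges (allPairs n) ⟩
    filterᵇ (λ e → isEdge G∖ab e ∧ inS e) (allPairs n)    ≡⟨ filterᵇ-filterᵇ inS _ (allPairs n) ⟨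
    edgesIn G∖ab S                                         ∎)
    where
    open ≡-Reasoning
    inS : Edge n → Bool
    inS e = S (proj₁ e) ∧ S (proj₂ e)
    isEdge : Graph n → Edge n → Bool
    isEdge K e = (toℕ (proj₁ e) <ᵇ toℕ (proj₂ e)) ∧ adj K (proj₁ e) (proj₂ e)
    not-both : ∀ i j → isAB i j ≡ true → (S i ∧ S j) ≡ false
    not-both i j ab with ∨-true ab
    ... | inj₁ i=a∧j=b with i=a , j=b ← ∧-true i=a∧j=b rewrite ==⇒≡ {i = i} i=a | ==⇒≡ {i = j} j=b = ¬ab
    ... | inj₂ i=b∧j=a with i=b , j=a ← ∧-true i=b∧j=a rewrite ==⇒≡ {i = i} i=b | ==⇒≡ {i = j} j=a =
      trans (BP.∧-comm (S b) (S a)) ¬ab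
    same-edges : ∀ e → isEdge G e ∧ inS e ≡ isEdge G∖ab e ∧ inS e
    same-edges (i , j) with isAB i j in ab
    ... | false = cong (λ t → ((toℕ i <ᵇ toℕ j) ∧ t) ∧ inS (i , j)) (sym (BP.∧-identityʳ (adj G i j)))
    ... | true  = trans (cong (isEdge G (i , j) ∧_) (not-both i j ab))
                        (trans (BP.∧-zeroʳ _)
                               (sym (trans (cong (((toℕ i <ᵇ toℕ j) ∧ (adj G i j ∧ false)) ∧_) (not-both i j ab))
                                           (BP.∧-zeroʳ _))))

  μ₁-G∖ab-∖a : ∀ S → μ₁ G (S ∖ a) ≡ μ₁ G∖ab (S ∖ a)
  μ₁-G∖ab-∖a S = μ₁-G∖ab (S ∖ a) (cong (λ t → (not t ∧ S a) ∧ (S ∖ a) b) (==-refl a))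

  -- The vertex recurrence at a, in G and in G - ab.
  μ₁-G-ab : ∀ S → S a ≡ true → S b ≡ true → μ₁ G S ≡ μ₁ G∖ab S - μ₁ G∖ab (S ∖ a ∖ b)
  μ₁-G-ab S Sa Sb = begin
    μ₁ G S
      ≡⟨ μ₁-vertex G S a Sa ⟩
    μ₁ G (S ∖ a) - ΣF n (λ v → if S v ∧ adj G a v then μ₁ G (S ∖ a ∖ v) else + 0)
      ≡⟨ cong₂ _-_ (μ₁-G∖ab-∖a S) (ΣF-split (λ v → S v ∧ adj G a v) (λ v → μ₁ G (S ∖ a ∖ v)) b) ⟩
    μ₁ G∖ab (S ∖ a) - (ΣF n (λ v → if (S v ∧ adj G a v) ∧ not (v == b) then μ₁ G (S ∖ a ∖ v) else + 0)
                       + (if S b ∧ adj G a b then μ₁ G (S ∖ a ∖ b) else + 0))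
      ≡⟨ cong (λ t → μ₁ G∖ab (S ∖ a) - t) (cong₂ _+_ (ΣF-cong n other-neighbours) neighbour-b) ⟩
    μ₁ G∖ab (S ∖ a) - (ΣF n (λ v → if S v ∧ adj G∖ab a v then μ₁ G∖ab (S ∖ a ∖ v) else + 0)
                       + μ₁ G∖ab (S ∖ a ∖ b))
      ≡⟨ regroup (μ₁ G∖ab (S ∖ a)) _ _ ⟩
    μ₁ G∖ab (S ∖ a) - ΣF n (λ v → if S v ∧ adj G∖ab a v then μ₁ G∖ab (S ∖ a ∖ v) else + 0)
      - μ₁ G∖ab (S ∖ a ∖ b)
      ≡⟨ cong (_- μ₁ G∖ab (S ∖ a ∖ b)) (μ₁-vertex G∖ab S a Sa) ⟨
    μ₁ G∖ab S - μ₁ G∖ab (S ∖ a ∖ b) ∎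
    where
    open ≡-Reasoning
    regroup : ∀ x s y → x - (s + y) ≡ x - s - y
    regroup = solve-∀
    μ₁-∖a∖v : ∀ v → μ₁ G (S ∖ a ∖ v) ≡ μ₁ G∖ab (S ∖ a ∖ v)
    μ₁-∖a∖v v = μ₁-G∖ab (S ∖ a ∖ v)
      (trans (cong (λ t → (not (a == v) ∧ (not t ∧ S a)) ∧ (S ∖ a ∖ v) b) (==-refl a))
             (cong (_∧ (S ∖ a ∖ v) b) (BP.∧-zeroʳ (not (a == v)))))
    isAB-a : ∀ v → isAB a v ≡ v == b
    isAB-a v rewrite ==-refl a | a≢b = BP.∨-identityʳ _
    other-neighbours : ∀ v → (if (S v ∧ adj G a v) ∧ not (v == b) then μ₁ G (S ∖ a ∖ v) else + 0)
                             ≡ (if S v ∧ adj G∖ab a v then μ₁ G∖ab (S ∖ a ∖ v) else + 0)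
    other-neighbours v rewrite isAB-a v | μ₁-∖a∖v v | BP.∧-assoc (S v) (adj G a v) (not (v == b)) = refl
    neighbour-b : (if S b ∧ adj G a b then μ₁ G (S ∖ a ∖ b) else + 0) ≡ μ₁ G∖ab (S ∖ a ∖ b)
    neighbour-b rewrite Sb | a~b = μ₁-∖a∖v b


  open SubdivisionAlgebra a b a≢b μ₁′ (μ₁ G∖ab) (μ₁ G) (μ₁-cong G∖ab)
                          μ₁′-old recurrence-x recurrence-z recurrence-y μ₁-G-ab μ₁-G∖ab public

-- Preserved by subdividing the distinguished edge ab, with zb as the new distinguished edge and -sgn as the new sign.
-- The last field is what gives μ(G′ ∖ y, 1) the right sign.
record SubdivisionInvariant (G : Graph n) : Set where
  field
    sgn          : ℤ
    a b          : Fin n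
    a~b          : adj G a b ≡ true
    μ₁-zero      : μ₁ G full ≡ + 0
    μ₁-∖-signed  : ∀ u → + 0 ℤ.< sgn * μ₁ G (full ∖ u)
    μ₁-ab-signed : + 0 ℤ.< sgn * ((μ₁ G (full ∖ a) + μ₁ G (full ∖ b))
                                 - (μ₁ G (full ∖ a ∖ b) + μ₁ G (full ∖ a ∖ b)))

subdivide : (G : Graph n) → SubdivisionInvariant G → Graph (3 ℕ.+ n)
subdivide G I = Subdivision.G′ G a b a~b
  where open SubdivisionInvariant I

subdivide-invariant : (G : Graph n) (I : SubdivisionInvariant G) → SubdivisionInvariant (subdivide G I)
subdivide-invariant G I = record
  { sgn          = - sgn
  ; a            = z₀
  ; b            = old b
  ; a~b          = ==-refl b
  ; μ₁-zero      = trans (μ₁-G′ full) (trans (F-all full) (cong -_ μ₁-zero))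
  ; μ₁-∖-signed  = signed
  ; μ₁-ab-signed = subst (+ 0 ℤ.<_)
                         (sym (ab-term (trans (μ₁-G′ (full ∖ z₀)) F-∖z)
                                       (trans (μ₁-G′ (full ∖ old b)) (F-all (full ∖ b)))
                                       (trans (μ₁-G′ (full ∖ z₀ ∖ old b)) F-∖z∖b)))
                         μ₁-ab-signed
  }
  where
  open SubdivisionInvariant I
  open Subdivision G a b a~b
  neg-neg : ∀ s x → - s * - x ≡ s * x
  neg-neg = solve-∀
  flipped : ∀ {x y} → y ≡ - x → + 0 ℤ.< sgn * x → + 0 ℤ.< - sgn * y
  flipped {x} refl 0<sx = subst (+ 0 ℤ.<_) (sym (neg-neg sgn x)) 0<sx
  Z : VertexSet _ → ℤ
  Z = μ₁ G
  y-signed : ∀ {t z x y w} → t ≡ z - x - y + (w + w) → z ≡ + 0 →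
             + 0 ℤ.< sgn * ((x + y) - (w + w)) → + 0 ℤ.< - sgn * t
  y-signed {x = x} {y} {w} refl refl = subst (+ 0 ℤ.<_) (sym (expand sgn x y w))
    where
    expand : ∀ s x y w → - s * (+ 0 - x - y + (w + w)) ≡ s * ((x + y) - (w + w))
    expand = solve-∀
  ab-term : ∀ {p q r x y w} → p ≡ - x → q ≡ - y → r ≡ - w →
            - sgn * ((p + q) - (r + r)) ≡ sgn * ((x + y) - (w + w))
  ab-term {x = x} {y} {w} refl refl refl = neg-all sgn x y w
    where
    neg-all : ∀ s x y w → - s * ((- x + - y) - (- w + - w)) ≡ s * ((x + y) - (w + w))
    neg-all = solve-∀
  signed : ∀ u → + 0 ℤ.< - sgn * μ₁ G′ (full ∖ u)
  signed x₀      = flipped (trans (μ₁-G′ (full ∖ x₀)) F-∖x) (μ₁-∖-signed b)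
  signed y₀      = y-signed {x = Z (full ∖ a)} {Z (full ∖ b)} {Z (full ∖ a ∖ b)}
                            (trans (μ₁-G′ (full ∖ y₀)) F-∖y) μ₁-zero μ₁-ab-signed
  signed z₀      = flipped (trans (μ₁-G′ (full ∖ z₀)) F-∖z) (μ₁-∖-signed a)
  signed (old u) = flipped (trans (μ₁-G′ (full ∖ old u)) (F-all (full ∖ u))) (μ₁-∖-signed u)

module _ {G : Graph n} where

  _++ʷ_ : ∀ {i j k} → Walk G i j → Walk G j k → Walk G i k
  here       ++ʷ q = q
  step i~j p ++ʷ q = step i~j (p ++ʷ q)

  reverseʷ : ∀ {i j} → Walk G i j → Walk G j i
  reverseʷ here                 = here
  reverseʷ (step {i} {j} i~j p) = reverseʷ p ++ʷ step (≡⇒T (trans (Graph.sym G j i) (T⇒≡ i~j))) here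

penultimate : A → A → List A → A
penultimate u w []       = u
penultimate u w (x ∷ ws) = penultimate w x ws

penultimate∈ : (u w x : A) (ws : List A) → penultimate u w (x ∷ ws) ∈ w ∷ x ∷ ws
penultimate∈ u w x []       = here refl
penultimate∈ u w x (y ∷ ws) = there (penultimate∈ w x y ws)

last-step : {G : Graph n} (u w : Fin n) (ws : List (Fin n)) → IsPath G (u ∷ w ∷ ws) →
            Adj G (penultimate u w ws) (last w ws)
last-step u w []       (cons u~w _) = u~w
last-step u w (x ∷ ws) (cons _ p)   = last-step w x ws p

record ParentTree (G : Graph n) : Set where
  field
    root        : Fin n
    parent      : Fin n → Fin n
    rank        : Fin n → ℕ
    parent-rank : ∀ i → (i == root) ≡ false → rank (parent i) < rank i
    parent-edge : ∀ i → (i == root) ≡ false → adj G i (parent i) ≡ true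
    edge-parent : ∀ i j → adj G i j ≡ true →
                  ((i == root) ≡ false × parent i ≡ j) ⊎ ((j == root) ≡ false × parent j ≡ i)

module _ {G : Graph n} (P : ParentTree G) where
  open ParentTree P

  walk-to-root : ∀ k i → rank i < k → Walk G i root
  walk-to-root (suc k) i rank<k with i == root in i==root
  ... | true with refl ← ==⇒≡ {i = i} i==root = here
  ... | false = step (≡⇒T (parent-edge i i==root))
                     (walk-to-root k (parent i) (ℕP.≤-trans (parent-rank i i==root) (ℕP.≤-pred rank<k)))

  ParentTree⇒Connected : Connected G
  ParentTree⇒Connected i j =
    walk-to-root (suc (rank i)) i ℕP.≤-refl ++ʷ reverseʷ (walk-to-root (suc (rank j)) j ℕP.≤-refl)

  adjacent-ranks : ∀ i j → adj G i j ≡ true → rank i < rank j ⊎ rank j < rank i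
  adjacent-ranks i j i~j with edge-parent i j i~j
  ... | inj₁ (i≠root , refl) = inj₂ (parent-rank i i≠root)
  ... | inj₂ (j≠root , refl) = inj₁ (parent-rank j j≠root)

  lower-neighbour-is-parent : ∀ i j → adj G i j ≡ true → rank j < rank i → parent i ≡ j
  lower-neighbour-is-parent i j i~j j<i with edge-parent i j i~j
  ... | inj₁ (_ , pi≡j)       = pi≡j
  ... | inj₂ (j≠root , refl) = ⊥-elim (ℕP.<-asym j<i (parent-rank j j≠root))

  lower-neighbours-equal : ∀ i j k → adj G i j ≡ true → adj G i k ≡ true → rank j < rank i → rank k < rank i → j ≡ k
  lower-neighbours-equal i j k i~j i~k j<i k<i =
    trans (sym (lower-neighbour-is-parent i j i~j j<i)) (lower-neighbour-is-parent i k i~k k<i)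

  -- Along a path without repeated vertices the rank cannot go up and then down again,
  -- since the top vertex would have two lower neighbours, i.e. two parents.
  path-ranks : ∀ u w ws → IsPath G (u ∷ w ∷ ws) → AllPairs _≢_ (u ∷ w ∷ ws) →
    (rank u < rank w → rank u < rank (last w ws) × rank (penultimate u w ws) < rank (last w ws)) ×
    (rank (last w ws) < rank (penultimate u w ws) → rank (last w ws) < rank u)
  path-ranks u w []       (cons _ _) _ = (λ u<w → u<w , u<w) , (λ w<u → w<u)
  path-ranks u w (x ∷ ws) (cons u~w p@(cons w~x _)) (u≢ ∷ distinct) = ascending , descending
    where
    ih = path-ranks w x ws p distinct
    w~u : adj G w u ≡ true
    w~u = trans (Graph.sym G w u) (T⇒≡ u~w)
    ascending : rank u < rank w → rank u < rank (last x ws) × rank (penultimate w x ws) < rank (last x ws)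
    ascending u<w with adjacent-ranks w x (T⇒≡ w~x)
    ... | inj₁ w<x = let (w<last , pen<last) = proj₁ ih w<x in ℕP.<-trans u<w w<last , pen<last
    ... | inj₂ x<w = ⊥-elim (All.lookup u≢ (there (here refl)) (lower-neighbours-equal w u x w~u (T⇒≡ w~x) u<w x<w))
    descending : rank (last x ws) < rank (penultimate w x ws) → rank (last x ws) < rank u
    descending last<pen with adjacent-ranks u w (T⇒≡ u~w)
    ... | inj₁ u<w = ⊥-elim (ℕP.<-asym last<pen (proj₂ (ascending u<w)))
    ... | inj₂ w<u = ℕP.<-trans (proj₂ ih last<pen) w<u

  ParentTree⇒¬HasCycle : ¬ HasCycle G
  ParentTree⇒¬HasCycle (v , []    , () , _)
  ParentTree⇒¬HasCycle (v , _ ∷ [] , s≤s () , _)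
  ParentTree⇒¬HasCycle (v , w ∷ x ∷ ws , _ , distinct@(v≢ ∷ w≢ ∷ _) , path@(cons v~w _) , last~v) =
    close (adjacent-ranks v w (T⇒≡ v~w)) (adjacent-ranks ℓ v (T⇒≡ last~v))
    where
    ℓ  = last w (x ∷ ws)
    pn = penultimate v w (x ∷ ws)
    ranks = path-ranks v w (x ∷ ws) path distinct
    v~ℓ : adj G v ℓ ≡ true
    v~ℓ = trans (Graph.sym G v ℓ) (T⇒≡ last~v)
    ℓ~pn : adj G ℓ pn ≡ true
    ℓ~pn = trans (Graph.sym G ℓ pn) (T⇒≡ (last-step v w (x ∷ ws) path))
    close : rank v < rank w ⊎ rank w < rank v → rank ℓ < rank v ⊎ rank v < rank ℓ → ⊥
    close (inj₁ v<w) (inj₁ ℓ<v) = ℕP.<-asym (proj₁ (proj₁ ranks v<w)) ℓ<v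
    close (inj₂ w<v) (inj₁ ℓ<v) =
      All.lookup w≢ (last∈ w x ws) (lower-neighbours-equal v w ℓ (T⇒≡ v~w) v~ℓ w<v ℓ<v)
    close _ (inj₂ v<ℓ) with adjacent-ranks ℓ pn ℓ~pn
    ... | inj₁ ℓ<pn = ℕP.<-asym (proj₂ ranks ℓ<pn) v<ℓ
    ... | inj₂ pn<ℓ = All.lookup v≢ (penultimate∈ v w x ws) (lower-neighbours-equal ℓ v pn (T⇒≡ last~v) ℓ~pn v<ℓ pn<ℓ)

  ParentTree⇒IsTree : IsTree G
  ParentTree⇒IsTree = ParentTree⇒Connected , ParentTree⇒¬HasCycle

ParentTreeWithEdge : (G : Graph n) (a b : Fin n) → Set
ParentTreeWithEdge G a b = Σ (ParentTree G) (λ P → ParentTree.parent P b ≡ a × (b == ParentTree.root P) ≡ false)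

module _ (G : Graph n) (a b : Fin n) (a~b : adj G a b ≡ true) where
  open Subdivision G a b a~b

  -- The new path b – z – y – x – a replaces the tree edge from b to its parent a.
  module SubdividedParentTree (P : ParentTree G) (pb≡a : ParentTree.parent P b ≡ a)
                              (b≠root : (b == ParentTree.root P) ≡ false) where
    open ParentTree P

    a<b : rank a < rank b
    a<b = subst (λ v → rank v < rank b) pb≡a (parent-rank b b≠root)

    parent′ : Fin (3 ℕ.+ n) → Fin (3 ℕ.+ n)
    parent′ x₀      = old a
    parent′ y₀      = x₀
    parent′ z₀      = y₀
    parent′ (old i) = if i == b then z₀ else old (parent i)

    parent′-b : parent′ (old b) ≡ z₀
    parent′-b = cong (λ c → if c then z₀ else old (parent b)) (==-refl b)

    -- Ranks are scaled by 4 to make room for x, y, z between a and b.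
    rank′ : Fin (3 ℕ.+ n) → ℕ
    rank′ x₀      = 1 ℕ.+ 4 ℕ.* rank a
    rank′ y₀      = 2 ℕ.+ 4 ℕ.* rank a
    rank′ z₀      = 3 ℕ.+ 4 ℕ.* rank a
    rank′ (old i) = 4 ℕ.* rank i

    root′ : Fin (3 ℕ.+ n)
    root′ = old root

    parent′-rank : ∀ i → (i == root′) ≡ false → rank′ (parent′ i) < rank′ i
    parent′-rank x₀      _ = ℕP.n<1+n _
    parent′-rank y₀      _ = ℕP.n<1+n _
    parent′-rank z₀      _ = ℕP.n<1+n _
    parent′-rank (old i) i≠root with i == b in i==b
    ... | true  with refl ← ==⇒≡ {i = i} i==b = ℕP.≤-trans (ℕP.≤-reflexive (regroup (rank a))) (ℕP.*-monoʳ-≤ 4 a<b)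
      where
      regroup : ∀ r → 4 ℕ.+ 4 ℕ.* r ≡ 4 ℕ.* suc r
      regroup = ℕSolver.solve-∀
    ... | false = ℕP.*-monoʳ-< 4 (parent-rank i i≠root)

    ¬isAB-parent : ∀ i → (i == root) ≡ false → (i == b) ≡ false → isAB i (parent i) ≡ false
    ¬isAB-parent i i≠root i≠b rewrite i≠b | BP.∧-zeroˡ (parent i == a)
      with i == a in i==a | parent i == b in pi==b
    ... | true  | true  with refl ← ==⇒≡ {i = i} i==a =
      ⊥-elim (ℕP.<-asym a<b (subst (λ v → rank v < rank a) (==⇒≡ pi==b) (parent-rank a i≠root)))
    ... | true  | false = refl
    ... | false | _     = refl

    isAB-b : isAB b (parent b) ≡ true
    isAB-b rewrite pb≡a | ==-refl a | ==-refl b = BP.∨-zeroʳ _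

    old-parent : ∀ k → isAB k (parent k) ≡ false → parent′ (old k) ≡ old (parent k)
    old-parent k ¬ab = not-b (k == b) refl
      where
      not-b : ∀ c → (k == b) ≡ c → (if c then z₀ else old (parent k)) ≡ old (parent k)
      not-b false _    = refl
      not-b true  k==b with () ← trans (sym (subst (λ v → isAB v (parent v) ≡ false) (==⇒≡ {i = k} {b} k==b) ¬ab)) isAB-b

    parent′-edge : ∀ i → (i == root′) ≡ false → adjG′ i (parent′ i) ≡ true
    parent′-edge x₀      _ = ==-refl a
    parent′-edge y₀      _ = refl
    parent′-edge z₀      _ = refl
    parent′-edge (old i) i≠root with i == b in i==b
    ... | true  = i==b
    ... | false = cong₂ _∧_ (parent-edge i i≠root) (cong not (¬isAB-parent i i≠root i==b))

    edge′-parent : ∀ i j → adjG′ i j ≡ true →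
                   ((i == root′) ≡ false × parent′ i ≡ j) ⊎ ((j == root′) ≡ false × parent′ j ≡ i)
    edge′-parent x₀      y₀      _ = inj₂ (refl , refl)
    edge′-parent x₀      (old j) j==a with refl ← ==⇒≡ {i = j} j==a = inj₁ (refl , refl)
    edge′-parent y₀      x₀      _ = inj₁ (refl , refl)
    edge′-parent y₀      z₀      _ = inj₂ (refl , refl)
    edge′-parent z₀      y₀      _ = inj₁ (refl , refl)
    edge′-parent z₀      (old j) j==b with refl ← ==⇒≡ {i = j} j==b =
      inj₂ (b≠root , parent′-b)
    edge′-parent (old i) x₀      i==a with refl ← ==⇒≡ {i = i} i==a = inj₂ (refl , refl)
    edge′-parent (old i) z₀      i==b with refl ← ==⇒≡ {i = i} i==b =
      inj₁ (b≠root , parent′-b)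
    edge′-parent (old i) (old j) i~′j with i~j , ¬ab ← ∧-true {adj G i j} i~′j with edge-parent i j i~j
    ... | inj₁ (i≠root , refl) = inj₁ (i≠root , old-parent i (not-true ¬ab))
    ... | inj₂ (j≠root , refl) = inj₂ (j≠root , old-parent j (trans (isAB-sym j i) (not-true ¬ab)))

    P′ : ParentTree G′
    P′ = record { root = root′ ; parent = parent′ ; rank = rank′
                ; parent-rank = parent′-rank ; parent-edge = parent′-edge ; edge-parent = edge′-parent }

  subdivide-ParentTree : ParentTreeWithEdge G a b → ParentTreeWithEdge G′ z₀ (old b)
  subdivide-ParentTree (P , pb≡a , b≠root) = P′ , parent′-b , b≠root
    where open SubdividedParentTree P pb≡a b≠root

PathAround : Graph n → Fin n → Fin n → Set
PathAround {n} G a b = Σ (List (Fin n)) (λ vs → 2 ≤ length vs × Unique (b ∷ vs) × IsPath G (b ∷ vs) × last b vs ≡ a)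

PathAround⇒¬IsTree : (G : Graph n) (a b : Fin n) → adj G a b ≡ true → PathAround G a b → ¬ IsTree G
PathAround⇒¬IsTree G a b a~b (vs , 2≤|vs| , distinct , path , last≡a) (_ , acyclic) =
  acyclic (b , vs , 2≤|vs| , distinct , path , subst (λ v → Adj G v b) (sym last≡a) (≡⇒T a~b))

module _ (G : Graph n) (a b : Fin n) (a~b : adj G a b ≡ true) where
  open Subdivision G a b a~b

  private
    xyz : List (Fin (3 ℕ.+ n))
    xyz = x₀ ∷ y₀ ∷ z₀ ∷ []

    old-path : ∀ w ws → IsPath G (w ∷ ws) → All (λ v → (v == b) ≡ false) (w ∷ ws) →
               IsPath G′ (map (λ i → old i) (w ∷ ws))
    old-path w []       one        _                 = one
    old-path w (v ∷ ws) (cons w~v p) (w≠b ∷ v≠b ∷ ≠b) = cons (≡⇒T w~′v) (old-path v ws p (v≠b ∷ ≠b))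
      where
      w~′v : adj G∖ab w v ≡ true
      w~′v rewrite w≠b | v≠b | BP.∧-zeroʳ (w == a) = trans (BP.∧-identityʳ (adj G w v)) (T⇒≡ w~v)

    then-xyz : ∀ w ws → IsPath G′ (map (λ i → old i) (w ∷ ws)) → Adj G′ (old (last w ws)) x₀ →
               IsPath G′ (map (λ i → old i) (w ∷ ws) ++ xyz)
    then-xyz w []       one          last~x = cons last~x (cons _ (cons _ one))
    then-xyz w (v ∷ ws) (cons w~v p) last~x = cons w~v (then-xyz v ws p last~x)

    last-xyz : (v : Fin (3 ℕ.+ n)) (vs : List (Fin (3 ℕ.+ n))) → last v (vs ++ xyz) ≡ z₀
    last-xyz v []       = refl
    last-xyz v (w ∷ vs) = last-xyz w vs

    old-xyz-distinct : (vs : List (Fin n)) → All (λ v → All (v ≢_) xyz) (map (λ i → old i) vs)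
    old-xyz-distinct []       = []
    old-xyz-distinct (_ ∷ vs) = ((λ ()) ∷ (λ ()) ∷ (λ ()) ∷ []) ∷ old-xyz-distinct vs

  -- The path b, …, a is continued by x, y, z.
  subdivide-PathAround : PathAround G a b → PathAround G′ z₀ (old b)
  subdivide-PathAround ([]    , () , _)
  subdivide-PathAround (_ ∷ [] , s≤s () , _)
  subdivide-PathAround (w₁ ∷ w₂ ∷ ws , _ , distinct@(b≢ ∷ w₁≢ ∷ _) , cons b~w₁ path , last≡a) =
    map (λ i → old i) (w₁ ∷ w₂ ∷ ws) ++ xyz , s≤s (s≤s z≤n) , distinct′ , path′ ,
    last-xyz (old b) (map (λ i → old i) (w₁ ∷ w₂ ∷ ws))
    where
    distinct′ : Unique (map (λ i → old i) (b ∷ w₁ ∷ w₂ ∷ ws) ++ xyz)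
    distinct′ = AllPairsP.++⁺ (AllPairsP.map⁺ (AllPairs.map (λ i≢j oi≡oj → i≢j (cong unold oi≡oj)) distinct))
                              (((λ ()) ∷ (λ ()) ∷ []) ∷ ((λ ()) ∷ []) ∷ [] ∷ [])
                              (old-xyz-distinct (b ∷ w₁ ∷ w₂ ∷ ws))
      where
      unold : Fin (3 ℕ.+ n) → Fin n
      unold (old i) = i
      unold _       = b
    ≠b : All (λ v → (v == b) ≡ false) (w₁ ∷ w₂ ∷ ws)
    ≠b = All.map (λ b≢v → ≢⇒==-false (b≢v ∘ sym)) b≢
    w₁≠a : (w₁ == a) ≡ false
    w₁≠a = ≢⇒==-false (λ w₁≡a → All.lookup w₁≢ (last∈ w₁ w₂ ws) (trans w₁≡a (sym last≡a)))
    b~′w₁ : adj G∖ab b w₁ ≡ true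
    b~′w₁ rewrite ==-sym b a | a≢b | ==-refl b | w₁≠a = trans (BP.∧-identityʳ (adj G b w₁)) (T⇒≡ b~w₁)
    path′ : IsPath G′ (old b ∷ map (λ i → old i) (w₁ ∷ w₂ ∷ ws) ++ xyz)
    path′ = cons (≡⇒T b~′w₁) (then-xyz w₁ (w₂ ∷ ws) (old-path w₁ (w₂ ∷ ws) path ≠b)
                                       (subst (λ v → Adj G′ (old v) x₀) (sym last≡a) (≡⇒T (==-refl a))))

allFinᵇ : ∀ n → (Fin n → Bool) → Bool
allFinᵇ zero    P = true
allFinᵇ (suc n) P = P zero ∧ allFinᵇ n (λ i → P (suc i))

allFinᵇ-sound : ∀ n (P : Fin n → Bool) → allFinᵇ n P ≡ true → ∀ i → P i ≡ true
allFinᵇ-sound (suc n) P all zero    = proj₁ (∧-true all)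
allFinᵇ-sound (suc n) P all (suc i) = allFinᵇ-sound n (λ i → P (suc i)) (proj₂ (∧-true {P zero} all)) i

adjacencyOf : List (ℕ × ℕ) → Fin n → Fin n → Bool
adjacencyOf []              i j = false
adjacencyOf ((u , v) ∷ es) i j =
  (((u ≡ᵇ toℕ i) ∧ (v ≡ᵇ toℕ j)) ∨ ((u ≡ᵇ toℕ j) ∧ (v ≡ᵇ toℕ i))) ∨ adjacencyOf es i j

adjacencyOf-sym : (es : List (ℕ × ℕ)) (i j : Fin n) → adjacencyOf es i j ≡ adjacencyOf es j i
adjacencyOf-sym []             i j = refl
adjacencyOf-sym ((u , v) ∷ es) i j =
  cong₂ _∨_ (BP.∨-comm ((u ≡ᵇ toℕ i) ∧ (v ≡ᵇ toℕ j)) _) (adjacencyOf-sym es i j)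

fromEdgeList : ∀ n (es : List (ℕ × ℕ)) → allFinᵇ n (λ i → not (adjacencyOf es i i)) ≡ true → Graph n
fromEdgeList n es loopless = record
  { adj    = adjacencyOf es
  ; sym    = adjacencyOf-sym es
  ; irrefl = λ i → not-true (allFinᵇ-sound n _ loopless i)
  }

positiveᵇ : ℤ → Bool
positiveᵇ x = isYes (+ 0 ℤ.<? x)

positiveᵇ-sound : ∀ x → positiveᵇ x ≡ true → + 0 ℤ.< x
positiveᵇ-sound x pos with + 0 ℤ.<? x
... | yes 0<x = 0<x

signed-by-computation : (G : Graph n) (s : ℤ) → allFinᵇ n (λ u → positiveᵇ (s * μ₁ G (full ∖ u))) ≡ true →
                        ∀ u → + 0 ℤ.< s * μ₁ G (full ∖ u)
signed-by-computation {n} G s all u = positiveᵇ-sound _ (allFinᵇ-sound n _ all u)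

parentTreeᵇ : (G : Graph n) (root : Fin n) (parent : Fin n → Fin n) (rank : Fin n → ℕ) →
  allFinᵇ n (λ i → i == root ∨ (rank (parent i) <ᵇ rank i)) ≡ true →
  allFinᵇ n (λ i → i == root ∨ adj G i (parent i)) ≡ true →
  allFinᵇ n (λ i → allFinᵇ n (λ j → not (adj G i j) ∨ ((not (i == root) ∧ parent i == j)
                                                       ∨ (not (j == root) ∧ parent j == i)))) ≡ true →
  ParentTree G
parentTreeᵇ {n} G root parent rank ranks edges edge-parents = record
  { root = root ; parent = parent ; rank = rank
  ; parent-rank = λ i i≠root → <ᵇ-true⇒< (at-non-root i i≠root (allFinᵇ-sound n _ ranks i))
  ; parent-edge = λ i i≠root → at-non-root i i≠root (allFinᵇ-sound n _ edges i)
  ; edge-parent = edge-parent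
  }
  where
  at-non-root : ∀ i {c} → (i == root) ≡ false → (i == root ∨ c) ≡ true → c ≡ true
  at-non-root i i≠root hyp rewrite i≠root = hyp
  edge-parent : ∀ i j → adj G i j ≡ true →
                ((i == root) ≡ false × parent i ≡ j) ⊎ ((j == root) ≡ false × parent j ≡ i)
  edge-parent i j i~j with allFinᵇ-sound n _ (allFinᵇ-sound n _ edge-parents i) j
  ... | hyp rewrite i~j with ∨-true {not (i == root) ∧ parent i == j} hyp
  ...   | inj₁ i-child with i≠root , pi==j ← ∧-true {not (i == root)} i-child = inj₁ (not-true i≠root , ==⇒≡ pi==j)
  ...   | inj₂ j-child with j≠root , pj==i ← ∧-true {not (j == root)} j-child = inj₂ (not-true j≠root , ==⇒≡ pj==i)

invariant-by-computation : (G : Graph n) (s : ℤ) (a b : Fin n) → adj G a b ≡ true → μ₁ G full ≡ + 0 →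
  allFinᵇ n (λ u → positiveᵇ (s * μ₁ G (full ∖ u))) ≡ true →
  positiveᵇ (s * ((μ₁ G (full ∖ a) + μ₁ G (full ∖ b)) - (μ₁ G (full ∖ a ∖ b) + μ₁ G (full ∖ a ∖ b)))) ≡ true →
  SubdivisionInvariant G
invariant-by-computation G s a b a~b μ₁-zero signed ab-signed = record
  { sgn = s ; a = a ; b = b ; a~b = a~b ; μ₁-zero = μ₁-zero
  ; μ₁-∖-signed = signed-by-computation G s signed
  ; μ₁-ab-signed = positiveᵇ-sound _ ab-signed
  }

distinct-by-computation : (vs : List (Fin n)) → True (AllPairs.allPairs? (λ i j → ¬? (i Fin.≟ j)) vs) → Unique vs
distinct-by-computation vs distinct = toWitness distinct

tree₉ : Graph 9
tree₉ = fromEdgeList 9 ((0 , 1) ∷ (0 , 2) ∷ (0 , 3) ∷ (1 , 4) ∷ (4 , 5) ∷ (5 , 6) ∷ (6 , 7) ∷ (6 , 8) ∷ []) refl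

tree₁₀ : Graph 10
tree₁₀ = fromEdgeList 10 ((0 , 1) ∷ (0 , 2) ∷ (0 , 3) ∷ (0 , 4) ∷ (0 , 5) ∷ (1 , 6) ∷ (1 , 7)
                         ∷ (2 , 8) ∷ (2 , 9) ∷ []) refl

tree₁₁ : Graph 11
tree₁₁ = fromEdgeList 11 ((0 , 1) ∷ (0 , 2) ∷ (0 , 3) ∷ (0 , 4) ∷ (1 , 5) ∷ (1 , 6) ∷ (1 , 7)
                         ∷ (2 , 8) ∷ (2 , 9) ∷ (2 , 10) ∷ []) refl

cyclic₅ : Graph 5
cyclic₅ = fromEdgeList 5 ((0 , 1) ∷ (0 , 2) ∷ (0 , 3) ∷ (1 , 4) ∷ (2 , 4) ∷ []) refl

cyclic₆ : Graph 6
cyclic₆ = fromEdgeList 6 ((0 , 1) ∷ (0 , 2) ∷ (0 , 3) ∷ (0 , 4) ∷ (1 , 2) ∷ (1 , 5) ∷ []) refl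

cyclic₇ : Graph 7
cyclic₇ = fromEdgeList 7 ((0 , 1) ∷ (0 , 2) ∷ (0 , 3) ∷ (0 , 4) ∷ (1 , 2) ∷ (1 , 3) ∷ (1 , 4)
                         ∷ (2 , 5) ∷ (2 , 6) ∷ (3 , 5) ∷ (3 , 6) ∷ (4 , 5) ∷ (4 , 6) ∷ []) refl

CriticalTree : ℕ → Set
CriticalTree n = Σ (Graph n) λ G → Σ (SubdivisionInvariant G) λ I →
                   ParentTreeWithEdge G (SubdivisionInvariant.a I) (SubdivisionInvariant.b I)

CriticalCyclic : ℕ → Set
CriticalCyclic n = Σ (Graph n) λ G → Σ (SubdivisionInvariant G) λ I →
                     PathAround G (SubdivisionInvariant.a I) (SubdivisionInvariant.b I)

criticalTree₉ : CriticalTree 9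
criticalTree₉ = tree₉ , invariant-by-computation tree₉ (+ 1) (# 0) (# 1) refl refl refl refl ,
  parentTreeᵇ tree₉ (# 0) (lookup parents) (lookup ranks) refl refl refl , refl , refl
  where
  parents : Vec (Fin 9) 9
  parents = # 0 ∷ # 0 ∷ # 0 ∷ # 0 ∷ # 1 ∷ # 4 ∷ # 5 ∷ # 6 ∷ # 6 ∷ []
  ranks : Vec ℕ 9
  ranks = 0 ∷ 1 ∷ 1 ∷ 1 ∷ 2 ∷ 3 ∷ 4 ∷ 5 ∷ 5 ∷ []

criticalTree₁₀ : CriticalTree 10
criticalTree₁₀ = tree₁₀ , invariant-by-computation tree₁₀ (+ 1) (# 0) (# 1) refl refl refl refl ,
  parentTreeᵇ tree₁₀ (# 0) (lookup parents) (lookup ranks) refl refl refl , refl , refl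
  where
  parents : Vec (Fin 10) 10
  parents = # 0 ∷ # 0 ∷ # 0 ∷ # 0 ∷ # 0 ∷ # 0 ∷ # 1 ∷ # 1 ∷ # 2 ∷ # 2 ∷ []
  ranks : Vec ℕ 10
  ranks = 0 ∷ 1 ∷ 1 ∷ 1 ∷ 1 ∷ 1 ∷ 2 ∷ 2 ∷ 2 ∷ 2 ∷ []

criticalTree₁₁ : CriticalTree 11
criticalTree₁₁ = tree₁₁ , invariant-by-computation tree₁₁ (+ 1) (# 0) (# 1) refl refl refl refl ,
  parentTreeᵇ tree₁₁ (# 0) (lookup parents) (lookup ranks) refl refl refl , refl , refl
  where
  parents : Vec (Fin 11) 11
  parents = # 0 ∷ # 0 ∷ # 0 ∷ # 0 ∷ # 0 ∷ # 1 ∷ # 1 ∷ # 1 ∷ # 2 ∷ # 2 ∷ # 2 ∷ []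
  ranks : Vec ℕ 11
  ranks = 0 ∷ 1 ∷ 1 ∷ 1 ∷ 1 ∷ 2 ∷ 2 ∷ 2 ∷ 2 ∷ 2 ∷ 2 ∷ []

criticalCyclic₅ : CriticalCyclic 5
criticalCyclic₅ = cyclic₅ , invariant-by-computation cyclic₅ (- + 1) (# 0) (# 1) refl refl refl refl ,
  (# 4 ∷ # 2 ∷ # 0 ∷ []) , s≤s (s≤s z≤n) , distinct-by-computation _ _ , cons _ (cons _ (cons _ one)) , refl

criticalCyclic₆ : CriticalCyclic 6
criticalCyclic₆ = cyclic₆ , invariant-by-computation cyclic₆ (- + 1) (# 0) (# 1) refl refl refl refl ,
  (# 2 ∷ # 0 ∷ []) , s≤s (s≤s z≤n) , distinct-by-computation _ _ , cons _ (cons _ one) , refl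

criticalCyclic₇ : CriticalCyclic 7
criticalCyclic₇ = cyclic₇ , invariant-by-computation cyclic₇ (+ 1) (# 0) (# 1) refl refl refl refl ,
  (# 2 ∷ # 0 ∷ []) , s≤s (s≤s z≤n) , distinct-by-computation _ _ , cons _ (cons _ one) , refl

criticalTree : ∀ k → CriticalTree (9 ℕ.+ k)
criticalTree 0 = criticalTree₉
criticalTree 1 = criticalTree₁₀
criticalTree 2 = criticalTree₁₁
criticalTree (suc (suc (suc k))) with G , I , P ← criticalTree k =
  subdivide G I , subdivide-invariant G I , subdivide-ParentTree G a b a~b P
  where open SubdivisionInvariant I

criticalCyclic : ∀ k → CriticalCyclic (5 ℕ.+ k)
criticalCyclic 0 = criticalCyclic₅
criticalCyclic 1 = criticalCyclic₆
criticalCyclic 2 = criticalCyclic₇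
criticalCyclic (suc (suc (suc k))) with G , I , C ← criticalCyclic k =
  subdivide G I , subdivide-invariant G I , subdivide-PathAround G a b a~b C
  where open SubdivisionInvariant I

SubdivisionInvariant⇒OneCritical : {G : Graph (suc n)} → SubdivisionInvariant G → OneCritical G
SubdivisionInvariant⇒OneCritical {G = G} I = oneCritical-criterion G sgn μ₁-zero μ₁-∖-signed
  where open SubdivisionInvariant I

from : {P : ℕ → Set} (n₀ : ℕ) → (∀ k → P (n₀ ℕ.+ k)) → ∀ n → n₀ ≤ n → P n
from {P} n₀ p n n₀≤n = subst P (ℕP.m+[n∸m]≡n n₀≤n) (p (n ∸ n₀))

theorem1p4 : (∀ n → 9 ≤ n → ∃[ G ] (IsTree {n} G × OneCritical G))
           × (∀ n → 5 ≤ n → ∃[ G ] (¬ IsTree {n} G × OneCritical G))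
theorem1p4 = from 9 tree , from 5 cyclic
  where
  tree : ∀ k → ∃[ G ] (IsTree {9 ℕ.+ k} G × OneCritical G)
  tree k with G , I , P , _ ← criticalTree k = G , ParentTree⇒IsTree P , SubdivisionInvariant⇒OneCritical I
  cyclic : ∀ k → ∃[ G ] (¬ IsTree {5 ℕ.+ k} G × OneCritical G)
  cyclic k with G , I , C ← criticalCyclic k =
    G , PathAround⇒¬IsTree G a b a~b C , SubdivisionInvariant⇒OneCritical I
    where open SubdivisionInvariant I
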